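{- For every $n\in\mathbb{N}$, the theory $T_n$ is dependent.
   Context: $L_n$ is the language consisting of unary predicates $P_m,Q_m$ for $m<n$, unary function symbols $f_m$ for $m+1<n$, and binary relation symbols $<_m$ for $m<n$. $T_n$ is the $L_n$-theory axiomatized by: (i) $\langle Q_m: m<n\rangle$ is a partition of the universe; (ii) $<_m$ is a dense linear order without end-points on $Q_m$; (iii) $P_m\subseteq Q_m$ is dense and co-dense in $Q_m$; (iv) for $m+1<n$, $f_m$ is a bijection from $P_{m+1}$ onto $Q_m\setminus P_m$ and from $Q_m\setminus P_m$ onto $P_{m+1}$, with $f_m(f_m(x))=x$, and $f_m$ is the identity on $\{x: x\notin P_{m+1}\cup(Q_m\setminus P_m)\}$; (v) for $m+1<n$, if $a_1<_m c_1$ and $a_2<_{m+1}c_2$ then there are $b_1\in Q_m\setminus P_m$, $b_2\in P_{m+1}$ with $a_1<_m b_1<_m c_1$, $a_2<_{m+1}b_2<_{m+1}c_2$ and $f_m(b_2)=b_1$. (This is the model completion of the universal theory given by (i), $<_m$ linear order on $Q_m$, $P_m\subseteq Q_m$, and the injectivity/involution conditions on $f_m$.) A complete first-order theory is dependent (NIP) if no formula $\varphi(x,y)$ has the independence property, i.e. there is no model containing $\langle a_i: i\in\omega\rangle$ and $\langle b_s: s\subseteq\omega\rangle$ with $\varphi(a_i,b_s)$ holding iff $i\in s$. -}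

module Defs where

open import Data.Nat using (ℕ; zero; suc; _<_; _+_)
open import Data.Nat.Properties using (n<1+n; <-trans; m<n⇒m<1+n)
open import Data.Fin using (Fin; zero; suc; #_)
open import Data.Bool using (Bool; true)
open import Data.Product using (Σ; _×_; _,_)
open import Data.Empty using (⊥)
open import Relation.Nullary using (¬_)
open import Relation.Binary.PropositionalEquality using (_≡_; _≢_)
open import Data.Vec.Functional using (Vector; _∷_; _++_)

-- Terms and formulas use de Bruijn variables: a formula with k free
-- variables is a Formula n k; (var zero) is the most recently bound one.

data Term (n k : ℕ) : Set where
  var : Fin k → Term n k
  fn  : (m : ℕ) → suc m < n → Term n k → Term n k

infix  4 _≐_
infixr 3 _∧'_
infixr 2 _∨'_
infixr 1 _⇒'_

data Formula (n k : ℕ) : Set where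
  ⊥'          : Formula n k
  _≐_         : Term n k → Term n k → Formula n k
  P' Q'       : (m : ℕ) → m < n → Term n k → Formula n k
  L'          : (m : ℕ) → m < n → Term n k → Term n k → Formula n k   -- x <_m y
  _∧'_ _∨'_ _⇒'_ : Formula n k → Formula n k → Formula n k
  ∀' ∃'       : Formula n (suc k) → Formula n k

¬' : ∀ {n k} → Formula n k → Formula n k
¬' φ = φ ⇒' ⊥'

bigOr : ∀ {n k} (j : ℕ) → ((m : ℕ) → m < j → Formula n k) → Formula n k
bigOr zero    F = ⊥'
bigOr (suc j) F = bigOr j (λ m p → F m (m<n⇒m<1+n p)) ∨' F j (n<1+n j)

-- L_n-structures (first-order structures: nonempty carrier, equality is
-- actual equality) and classical Tarski semantics, rendered in Agda's
-- constructive metatheory via the negative (Goedel–Gentzen) translation.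

record Structure (n : ℕ) : Set₁ where
  field
    Carrier : Set
    point   : Carrier
    Pᴹ Qᴹ   : (m : ℕ) → m < n → Carrier → Set
    Lᴹ      : (m : ℕ) → m < n → Carrier → Carrier → Set
    fᴹ      : (m : ℕ) → suc m < n → Carrier → Carrier

open Structure public

evalT : ∀ {n k} (M : Structure n) → Vector (Carrier M) k → Term n k → Carrier M
evalT M ρ (var i)    = ρ i
evalT M ρ (fn m q t) = fᴹ M m q (evalT M ρ t)

Sat : ∀ {n k} (M : Structure n) → Formula n k → Vector (Carrier M) k → Set
Sat M ⊥'          ρ = ⊥
Sat M (t ≐ u)     ρ = ¬ ¬ (evalT M ρ t ≡ evalT M ρ u)
Sat M (P' m p t)  ρ = ¬ ¬ Pᴹ M m p (evalT M ρ t)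
Sat M (Q' m p t)  ρ = ¬ ¬ Qᴹ M m p (evalT M ρ t)
Sat M (L' m p t u) ρ = ¬ ¬ Lᴹ M m p (evalT M ρ t) (evalT M ρ u)
Sat M (φ ∧' ψ)    ρ = Sat M φ ρ × Sat M ψ ρ
Sat M (φ ∨' ψ)    ρ = ¬ ((¬ Sat M φ ρ) × (¬ Sat M ψ ρ))
Sat M (φ ⇒' ψ)    ρ = Sat M φ ρ → Sat M ψ ρ
Sat M (∀' φ)      ρ = (a : Carrier M) → Sat M φ (a ∷ ρ)
Sat M (∃' φ)      ρ = ¬ ((a : Carrier M) → ¬ Sat M φ (a ∷ ρ))

data Axiom (n : ℕ) : Set where
  cover    : Axiom n
  disjoint : (m m' : ℕ) → m < n → m' < n → m ≢ m' → Axiom n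
  lt-dom lt-irrefl lt-trans lt-total lt-dense lt-nomax lt-nomin
    P-sub P-dense P-codense : (m : ℕ) → m < n → Axiom n
  f-to f-from f-inj₁ f-inj₂ f-onto₁ f-onto₂ f-invol f-id f-ext
    : (m : ℕ) → suc m < n → Axiom n

axiom : ∀ {n} → Axiom n → Formula n 0
axiom {n} cover = ∀' (bigOr n (λ m p → Q' m p (var (# 0))))
axiom (disjoint m m' p p' _) = ∀' (¬' (Q' m p (var (# 0)) ∧' Q' m' p' (var (# 0))))
axiom (lt-dom m p) = ∀' (∀' (L' m p (var (# 1)) (var (# 0)) ⇒'
                              (Q' m p (var (# 1)) ∧' Q' m p (var (# 0)))))
axiom (lt-irrefl m p) = ∀' (¬' (L' m p (var (# 0)) (var (# 0))))
axiom (lt-trans m p) = ∀' (∀' (∀' ((L' m p (var (# 2)) (var (# 1)) ∧' L' m p (var (# 1)) (var (# 0)))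
                                    ⇒' L' m p (var (# 2)) (var (# 0)))))
axiom (lt-total m p) = ∀' (∀' ((Q' m p (var (# 1)) ∧' Q' m p (var (# 0))) ⇒'
                         (L' m p (var (# 1)) (var (# 0)) ∨' ((var (# 1) ≐ var (# 0)) ∨' L' m p (var (# 0)) (var (# 1))))))
axiom (lt-dense m p) = ∀' (∀' (L' m p (var (# 1)) (var (# 0)) ⇒'
                         ∃' (L' m p (var (# 2)) (var (# 0)) ∧' L' m p (var (# 0)) (var (# 1)))))
axiom (lt-nomax m p) = ∀' (Q' m p (var (# 0)) ⇒' ∃' (L' m p (var (# 1)) (var (# 0))))
axiom (lt-nomin m p) = ∀' (Q' m p (var (# 0)) ⇒' ∃' (L' m p (var (# 0)) (var (# 1))))
axiom (P-sub m p) = ∀' (P' m p (var (# 0)) ⇒' Q' m p (var (# 0)))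
axiom (P-dense m p) = ∀' (∀' (L' m p (var (# 1)) (var (# 0)) ⇒'
                         ∃' (P' m p (var (# 0)) ∧' (L' m p (var (# 2)) (var (# 0)) ∧' L' m p (var (# 0)) (var (# 1))))))
axiom (P-codense m p) = ∀' (∀' (L' m p (var (# 1)) (var (# 0)) ⇒'
                         ∃' (¬' (P' m p (var (# 0))) ∧' (L' m p (var (# 2)) (var (# 0)) ∧' L' m p (var (# 0)) (var (# 1))))))
axiom (f-to m q) = ∀' (A (var (# 0)) ⇒' N (fn m q (var (# 0))))
  where pm = <-trans (n<1+n m) q
        A N : ∀ {k} → Term _ k → Formula _ k
        A x = P' (suc m) q x
        N x = Q' m pm x ∧' ¬' (P' m pm x)
axiom (f-from m q) = ∀' (N (var (# 0)) ⇒' A (fn m q (var (# 0))))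
  where pm = <-trans (n<1+n m) q
        A N : ∀ {k} → Term _ k → Formula _ k
        A x = P' (suc m) q x
        N x = Q' m pm x ∧' ¬' (P' m pm x)
axiom (f-inj₁ m q) = ∀' (∀' ((A (var (# 1)) ∧' A (var (# 0)) ∧' (fn m q (var (# 1)) ≐ fn m q (var (# 0))))
                            ⇒' (var (# 1) ≐ var (# 0))))
  where A : ∀ {k} → Term _ k → Formula _ k
        A x = P' (suc m) q x
axiom (f-inj₂ m q) = ∀' (∀' ((N (var (# 1)) ∧' N (var (# 0)) ∧' (fn m q (var (# 1)) ≐ fn m q (var (# 0))))
                            ⇒' (var (# 1) ≐ var (# 0))))
  where pm = <-trans (n<1+n m) q
        N : ∀ {k} → Term _ k → Formula _ k
        N x = Q' m pm x ∧' ¬' (P' m pm x)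
axiom (f-onto₁ m q) = ∀' (N (var (# 0)) ⇒' ∃' (A (var (# 0)) ∧' (fn m q (var (# 0)) ≐ var (# 1))))
  where pm = <-trans (n<1+n m) q
        A N : ∀ {k} → Term _ k → Formula _ k
        A x = P' (suc m) q x
        N x = Q' m pm x ∧' ¬' (P' m pm x)
axiom (f-onto₂ m q) = ∀' (A (var (# 0)) ⇒' ∃' (N (var (# 0)) ∧' (fn m q (var (# 0)) ≐ var (# 1))))
  where pm = <-trans (n<1+n m) q
        A N : ∀ {k} → Term _ k → Formula _ k
        A x = P' (suc m) q x
        N x = Q' m pm x ∧' ¬' (P' m pm x)
axiom (f-invol m q) = ∀' (fn m q (fn m q (var (# 0))) ≐ var (# 0))
axiom (f-id m q) = ∀' ((¬' (A (var (# 0))) ∧' ¬' (N (var (# 0)))) ⇒' (fn m q (var (# 0)) ≐ var (# 0)))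
  where pm = <-trans (n<1+n m) q
        A N : ∀ {k} → Term _ k → Formula _ k
        A x = P' (suc m) q x
        N x = Q' m pm x ∧' ¬' (P' m pm x)
-- ∀a₁ c₁ a₂ c₂ (a₁ <_m c₁ ∧ a₂ <_{m+1} c₂ →
--   ∃b₁ b₂ (b₁ ∈ Q_m∖P_m ∧ b₂ ∈ P_{m+1} ∧ a₁<b₁<c₁ ∧ a₂<b₂<c₂ ∧ f_m(b₂)=b₁))
axiom (f-ext m q) =
  ∀' (∀' (∀' (∀' ((L' m pm (var (# 3)) (var (# 2)) ∧' L' (suc m) q (var (# 1)) (var (# 0))) ⇒'
    ∃' (∃' (N (var (# 1)) ∧' A (var (# 0))
            ∧' (L' m pm (var (# 5)) (var (# 1)) ∧' L' m pm (var (# 1)) (var (# 4)))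
            ∧' (L' (suc m) q (var (# 3)) (var (# 0)) ∧' L' (suc m) q (var (# 0)) (var (# 2)))
            ∧' (fn m q (var (# 0)) ≐ var (# 1))))))))
  where pm = <-trans (n<1+n m) q
        A N : ∀ {k} → Term _ k → Formula _ k
        A x = P' (suc m) q x
        N x = Q' m pm x ∧' ¬' (P' m pm x)

IsModel : ∀ {n} → Structure n → Set
IsModel {n} M = (ax : Axiom n) → Sat M (axiom ax) (λ ())

-- Subsets of ω are functions ℕ → Bool.

HasIP : ℕ → Set₁
HasIP n =
  Σ (Structure n) λ M → IsModel M ×
  Σ ℕ λ p → Σ ℕ λ q → Σ (Formula n (p + q)) λ φ →
  Σ (ℕ → Vector (Carrier M) p) λ a →
  Σ ((ℕ → Bool) → Vector (Carrier M) q) λ b →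
  (i : ℕ) (s : ℕ → Bool) →
    (Sat M φ (a i ++ b s) → s i ≡ true) × (s i ≡ true → Sat M φ (a i ++ b s))

Dependent : ℕ → Set₁
Dependent n = ¬ HasIP n

module Submission where

-- Any two finite f-closed families in a model of T_n with the same atomic diagram satisfy the
-- same formulas: by the density axioms a new element (together with its f-partner, found by axiom (v) if
-- it has one) can always be matched on the other side, so a back-and-forth argument goes through.  Every
-- element lies in a single Q_m and only f_(m-1) or f_m can move it, so the f-closure of a tuple is the
-- tuple plus one partner per entry.  Hence, over the closure A of parameter tuples a_0, ..., a_(N-1), the
-- formulas satisfied by a q-tuple b are determined by finitely many data: the kinds and atomic diagram of
-- its closure and, for each closure element, which element of A it equals and its cut in A in each order.
-- There are at most W ^ r such codes, with W linear in N and r independent of N.  Once W ^ r < 2 ^ N, two of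
-- the 2 ^ N tuples b_s with s ⊆ N share a code, and then φ(a_i, b_s) cannot hold exactly when i ∈ s.
--
-- Sat reads formulas through the double-negation translation, so the whole argument runs in the ¬¬ monad.

open import Defs
open import Level using (0ℓ)
open import Data.Nat using (ℕ; zero; suc; _<_; _≤_; _+_; _*_; _^_; _≟_; _<?_; z≤n; s≤s; z<s)
open import Data.Nat.Properties
  using (n<1+n; m<n⇒m<1+n; <-irrelevant; <-trans; suc-injective; ≤-trans; <-≤-trans; <⇒≤; m≤m+n; m≤n+m;
         m≤n*m; +-monoʳ-≤; *-comm; *-distribˡ-+; *-mono-<; *-monoʳ-≤; ^-monoˡ-≤; ^-monoʳ-<;
         ^-distribˡ-+-*; ^-*-assoc; *-distribʳ-+; m^n>0; m^n≢0; m<m+n; +-identityʳ; module ≤-Reasoning)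
open import Data.Nat.Solver using (module +-*-Solver)
open import Data.Fin as Fin using (Fin; zero; suc; toℕ; fromℕ<; combine; remQuot; splitAt)
open import Data.Fin.Properties
  using (<-irrefl; toℕ<n; toℕ-fromℕ<; toℕ-injective; combine-injective; combine-injectiveˡ; combine-injectiveʳ;
         combine-remQuot; pigeonhole)
open import Data.Bool using (Bool; true; false; not; if_then_else_)
open import Data.Maybe using (Maybe; just; nothing)
open import Data.Product using (Σ; ∃; ∃₂; _×_; _,_; proj₁; proj₂; uncurry)
open import Data.Product.Properties using (Σ-≡,≡→≡)
open import Data.Sum as Sum using (_⊎_; inj₁; inj₂; [_,_])
open import Data.Empty using (⊥; ⊥-elim)
open import Data.Unit using (⊤; tt)
open import Data.List using (List; []; _∷_; map; _++_; concat; length; cartesianProduct; allFin)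
open import Data.List.Membership.Propositional using (_∈_)
open import Data.List.Membership.Propositional.Properties
  using (∈-map⁺; ∈-++⁺ˡ; ∈-++⁺ʳ; ∈-concat⁺′; ∈-cartesianProduct⁺; ∈-allFin)
open import Data.List.Relation.Unary.Any using (here; there)
open import Data.Vec.Functional using (Vector) renaming (_∷_ to _∷ᵥ_; _++_ to _++ᵥ_)
open import Function using (_∘_; id; flip; _⇔_; mk⇔; Equivalence)
open import Function.Construct.Identity using (⇔-id)
open import Function.Construct.Symmetry using (⇔-sym)
open import Relation.Nullary using (¬_; Dec; yes; no)
open import Relation.Nullary.Negation using (Stable; ¬¬-Monad; negated-stable; ¬¬-map)
open import Relation.Nullary.Decidable using (¬¬-excluded-middle)
open import Relation.Binary.PropositionalEquality
  using (_≡_; _≢_; refl; sym; trans; cong; cong₂; subst; subst₂; _≗_; module ≡-Reasoning)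
open import Effect.Monad using (RawMonad)

open RawMonad (¬¬-Monad {0ℓ}) using (pure; _>>=_)
open Equivalence using (to; from)

private variable
  X Y C I J : Set

infix 4 _≈_
_≈_ : X → X → Set
x ≈ y = ¬ ¬ (x ≡ y)

≈-refl : {x : X} → x ≈ x
≈-refl = pure refl

≈-sym : {x y : X} → x ≈ y → y ≈ x
≈-sym = ¬¬-map sym

≈-trans : {x y z : X} → x ≈ y → y ≈ z → x ≈ z
≈-trans e e′ = e >>= λ { refl → e′ }

≈-cong : (g : X → Y) {x y : X} → x ≈ y → g x ≈ g y
≈-cong g = ¬¬-map (cong g)

≈-subst : (F : X → Set) {x y : X} → x ≈ y → ¬ ¬ F x → ¬ ¬ F y
≈-subst F e h = e >>= λ { refl → h }

≈-subst₂ : (F : X → Y → Set) {x x′ : X} {y y′ : Y} → x ≈ x′ → y ≈ y′ → ¬ ¬ F x y → ¬ ¬ F x′ y′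
≈-subst₂ F e e′ h = e >>= λ { refl → e′ >>= λ { refl → h } }

⇔-resp-≈ : (F : X → Set) {x x′ y y′ : X} → x ≈ x′ → y ≈ y′ →
           ((¬ ¬ F x) ⇔ (¬ ¬ F y)) → ((¬ ¬ F x′) ⇔ (¬ ¬ F y′))
⇔-resp-≈ F ex ey e =
  mk⇔ (≈-subst F ey ∘ to e ∘ ≈-subst F (≈-sym ex)) (≈-subst F ex ∘ from e ∘ ≈-subst F (≈-sym ey))

⇔-resp-≈₂ : (F : X → X → Set) {x x′ y y′ z z′ w w′ : X} → x ≈ x′ → y ≈ y′ → z ≈ z′ → w ≈ w′ →
            ((¬ ¬ F x y) ⇔ (¬ ¬ F z w)) → ((¬ ¬ F x′ y′) ⇔ (¬ ¬ F z′ w′))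
⇔-resp-≈₂ F ex ey ez ew e =
  mk⇔ (≈-subst₂ F ez ew ∘ to e ∘ ≈-subst₂ F (≈-sym ex) (≈-sym ey))
      (≈-subst₂ F ex ey ∘ from e ∘ ≈-subst₂ F (≈-sym ez) (≈-sym ew))

≈-sym-⇔ : {x y x′ y′ : X} → x ≈ y ⇔ x′ ≈ y′ → y ≈ x ⇔ y′ ≈ x′
≈-sym-⇔ e = mk⇔ (≈-sym ∘ to e ∘ ≈-sym) (≈-sym ∘ from e ∘ ≈-sym)

both-true : X → Y → X ⇔ Y
both-true x y = mk⇔ (λ _ → y) (λ _ → x)

both-false : ¬ X → ¬ Y → X ⇔ Y
both-false ¬x ¬y = mk⇔ (⊥-elim ∘ ¬x) (⊥-elim ∘ ¬y)

Stable-⊥ : Stable ⊥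
Stable-⊥ ¬¬⊥ = ¬¬⊥ id

Stable-× : Stable X → Stable Y → Stable (X × Y)
Stable-× sa sb ¬¬ab = sa (¬¬-map proj₁ ¬¬ab) , sb (¬¬-map proj₂ ¬¬ab)

Stable-Π : {F : X → Set} → (∀ x → Stable (F x)) → Stable (∀ x → F x)
Stable-Π s ¬¬f x = s x (¬¬-map (λ f → f x) ¬¬f)

Listable : Set → Set
Listable I = Σ (List I) λ xs → ∀ i → i ∈ xs

Listable-Fin : ∀ k → Listable (Fin k)
Listable-Fin k = allFin k , ∈-allFin

Listable-Bool : Listable Bool
Listable-Bool = true ∷ false ∷ [] , λ { true → here refl ; false → there (here refl) }

Listable-⊎ : Listable I → Listable J → Listable (I ⊎ J)
Listable-⊎ (xs , ∈xs) (ys , ∈ys) = map inj₁ xs ++ map inj₂ ys , λ where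
  (inj₁ i) → ∈-++⁺ˡ (∈-map⁺ inj₁ (∈xs i))
  (inj₂ j) → ∈-++⁺ʳ (map inj₁ xs) (∈-map⁺ inj₂ (∈ys j))

Listable-× : Listable I → Listable J → Listable (I × J)
Listable-× (xs , ∈xs) (ys , ∈ys) = cartesianProduct xs ys , λ (i , j) → ∈-cartesianProduct⁺ (∈xs i) (∈ys j)

¬¬-choice : {F : I → Set} → Listable I → (∀ i → ¬ ¬ F i) → ¬ ¬ (∀ i → F i)
¬¬-choice {I = I} {F} (xs , ∈xs) h = ¬¬-map (λ g i → g i (∈xs i)) (go xs)
  where
    go : (xs : List I) → ¬ ¬ (∀ i → i ∈ xs → F i)
    go [] = pure λ _ ()
    go (x ∷ xs) = h x >>= λ Fx → go xs >>= λ g → pure λ { i (here refl) → Fx ; i (there i∈xs) → g i i∈xs }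

-- Linear orders without end-points, read classically

record UnboundedOrder {C : Set} (_⊏_ : C → C → Set) (Dom : C → Set) : Set where
  field
    ⊏-stable       : ∀ {x y} → Stable (x ⊏ y)
    Dom-stable     : ∀ {x} → Stable (Dom x)
    ⊏-trans        : ∀ {x y z} → x ⊏ y → y ⊏ z → x ⊏ z
    ⊏-irrefl       : ∀ {x} → ¬ x ⊏ x
    ⊏-dom          : ∀ {x y} → x ⊏ y → Dom x × Dom y
    ⊏-trichotomous : ∀ {x y} → Dom x → Dom y → ¬ ¬ (x ⊏ y ⊎ x ≈ y ⊎ y ⊏ x)
    noMax          : ∀ {x} → Dom x → ¬ ¬ ∃ (x ⊏_)
    noMin          : ∀ {x} → Dom x → ¬ ¬ ∃ (_⊏ x)

  ⊏-resp-≈ : ∀ {x x′ y y′} → x ≈ x′ → y ≈ y′ → x ⊏ y → x′ ⊏ y′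
  ⊏-resp-≈ e e′ l = ⊏-stable (≈-subst₂ _⊏_ e e′ (pure l))

  Dom-resp-≈ : ∀ {x x′} → x ≈ x′ → Dom x → Dom x′
  Dom-resp-≈ e d = Dom-stable (≈-subst Dom e (pure d))

  infix 4 _⊑_
  _⊑_ : C → C → Set
  x ⊑ y = ¬ ¬ (x ⊏ y ⊎ x ≈ y)

  ⊑-⊏-trans : ∀ {x y z} → x ⊑ y → y ⊏ z → x ⊏ z
  ⊑-⊏-trans x⊑y y⊏z = ⊏-stable (x⊑y >>= λ where
    (inj₁ x⊏y) → pure (⊏-trans x⊏y y⊏z)
    (inj₂ x≈y) → pure (⊏-resp-≈ (≈-sym x≈y) ≈-refl y⊏z))

reverse : {_⊏_ : C → C → Set} {Dom : C → Set} → UnboundedOrder _⊏_ Dom → UnboundedOrder (flip _⊏_) Dom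
reverse {_⊏_ = _⊏_} O = record
  { ⊏-stable = ⊏-stable
  ; Dom-stable = Dom-stable
  ; ⊏-trans = λ x⊐y y⊐z → ⊏-trans y⊐z x⊐y
  ; ⊏-irrefl = ⊏-irrefl
  ; ⊏-dom = λ x⊐y → proj₂ (⊏-dom x⊐y) , proj₁ (⊏-dom x⊐y)
  ; ⊏-trichotomous = λ dx dy → ¬¬-map mirror (⊏-trichotomous dx dy)
  ; noMax = noMin
  ; noMin = noMax
  }
  where
    open UnboundedOrder O
    mirror : ∀ {x y} → (x ⊏ y ⊎ x ≈ y ⊎ y ⊏ x) → (y ⊏ x ⊎ x ≈ y ⊎ x ⊏ y)
    mirror (inj₁ x⊏y) = inj₂ (inj₂ x⊏y)
    mirror (inj₂ (inj₁ x≈y)) = inj₂ (inj₁ x≈y)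
    mirror (inj₂ (inj₂ y⊏x)) = inj₁ y⊏x

Fresh : (I → C) → C → Set
Fresh R x = ∀ j → ¬ x ≈ R j

module Below {_⊏_ : C → C → Set} {Dom : C → Set} (O : UnboundedOrder _⊏_ Dom) {I : Set} (R : I → C) where
  open UnboundedOrder O

  IsGreatestBelow : C → Maybe I → Set
  IsGreatestBelow x (just l) = R l ⊏ x × (∀ j → R j ⊏ x → R j ⊑ R l)
  IsGreatestBelow x nothing  = ∀ j → ¬ R j ⊏ x

  greatestBelow : Listable I → (x : C) → ¬ ¬ ∃ (IsGreatestBelow x)
  greatestBelow (xs , ∈xs) x = ¬¬-map complete (among xs)
    where
      Among : List I → Maybe I → Set
      Among ys (just l) = R l ⊏ x × (∀ j → j ∈ ys → R j ⊏ x → R j ⊑ R l)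
      Among ys nothing  = ∀ j → j ∈ ys → ¬ R j ⊏ x

      complete : ∃ (Among xs) → ∃ (IsGreatestBelow x)
      complete (just l , l⊏x , max) = just l , l⊏x , λ j → max j (∈xs j)
      complete (nothing , none) = nothing , λ j → none j (∈xs j)

      among : (ys : List I) → ¬ ¬ ∃ (Among ys)
      among [] = pure (nothing , λ _ ())
      among (y ∷ ys) = among ys >>= λ (v , a) → ¬¬-excluded-middle >>= step v a
        where
          step : (v : Maybe I) → Among ys v → Dec (R y ⊏ x) → ¬ ¬ ∃ (Among (y ∷ ys))
          step nothing none (no y⋢x) = pure (nothing , λ { j (here refl) → y⋢x ; j (there j∈) → none j j∈ })
          step (just l) (l⊏x , max) (no y⋢x) =
            pure (just l , l⊏x , λ { j (here refl) y⊏x → ⊥-elim (y⋢x y⊏x) ; j (there j∈) → max j j∈ })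
          step nothing none (yes y⊏x) =
            pure (just y , y⊏x , λ where
              j (here refl) _ → pure (inj₂ ≈-refl)
              j (there j∈) j⊏x → ⊥-elim (none j j∈ j⊏x))
          step (just l) (l⊏x , max) (yes y⊏x) = ⊏-trichotomous (proj₁ (⊏-dom y⊏x)) (proj₁ (⊏-dom l⊏x)) >>= λ where
            (inj₁ y⊏l) → pure (just l , l⊏x , λ { j (here refl) _ → pure (inj₁ y⊏l) ; j (there j∈) → max j j∈ })
            (inj₂ (inj₁ y≈l)) →
              pure (just l , l⊏x , λ { j (here refl) _ → pure (inj₂ y≈l) ; j (there j∈) → max j j∈ })
            (inj₂ (inj₂ l⊏y)) → pure (just y , y⊏x , λ where
              j (here refl) _ → pure (inj₂ ≈-refl)
              j (there j∈) j⊏x → pure (inj₁ (⊑-⊏-trans (max j j∈ j⊏x) l⊏y)))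

  IsGreatestBelow-⊏ : ∀ {y y′} v → IsGreatestBelow y v → IsGreatestBelow y′ v → ∀ w → R w ⊏ y → R w ⊏ y′
  IsGreatestBelow-⊏ (just l) (_ , max) (l⊏y′ , _) w w⊏y = ⊑-⊏-trans (max w w⊏y) l⊏y′
  IsGreatestBelow-⊏ nothing none _ w w⊏y = ⊥-elim (none w w⊏y)

-- The lower half of a cut of R is matched with the lower half of the
-- corresponding cut of R′; the upper halves are handled by the same module for the reversed order.
module LowerCuts {_⊏_ : C → C → Set} {Dom : C → Set} (O : UnboundedOrder _⊏_ Dom)
    {I : Set} (R R′ : I → C)
    (≈-iff : ∀ i j → R i ≈ R j ⇔ R′ i ≈ R′ j)
    (⊏-iff : ∀ i j → R i ⊏ R j ⇔ R′ i ⊏ R′ j)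
    (Dom-iff : ∀ i → Dom (R i) ⇔ Dom (R′ i)) where
  open UnboundedOrder O
  open Below O R using (IsGreatestBelow)
  open Below (reverse O) R using () renaming (IsGreatestBelow to IsLeastAbove)

  Above′ : C → Maybe I → Set
  Above′ x′ (just l) = R′ l ⊏ x′
  Above′ x′ nothing  = ⊤

  Below′ : C → Maybe I → Set
  Below′ x′ (just h) = x′ ⊏ R′ h
  Below′ x′ nothing  = ⊤

  ⊑-transfer : ∀ i j → R i ⊑ R j → R′ i ⊑ R′ j
  ⊑-transfer i j = ¬¬-map λ where
    (inj₁ i⊏j) → inj₁ (to (⊏-iff i j) i⊏j)
    (inj₂ i≈j) → inj₂ (to (≈-iff i j) i≈j)

  below-to : ∀ {x x′} lo → IsGreatestBelow x lo → Above′ x′ lo → ∀ j → R j ⊏ x → R′ j ⊏ x′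
  below-to nothing none _ j j⊏x = ⊥-elim (none j j⊏x)
  below-to (just l) (_ , max) l⊏x′ j j⊏x = ⊑-⊏-trans (⊑-transfer j l (max j j⊏x)) l⊏x′

  below-from : ∀ {x x′} → Dom x → Fresh R x → ∀ hi → IsLeastAbove x hi → Below′ x′ hi →
               ∀ j → R′ j ⊏ x′ → R j ⊏ x
  below-from {x} {x′} dx fresh hi least x′⊏hi j j⊏x′ = ⊏-stable (¬¬-map decide
    (⊏-trichotomous (from (Dom-iff j) (proj₁ (⊏-dom j⊏x′))) dx))
    where
      no-entry-between : ∀ hi → IsLeastAbove x hi → Below′ x′ hi → ¬ x ⊏ R j
      no-entry-between nothing none _ x⊏j = none j x⊏j
      no-entry-between (just h) (_ , min) x′⊏h x⊏j =
        ⊏-irrefl (⊏-trans j⊏x′ (UnboundedOrder.⊑-⊏-trans (reverse O) (¬¬-map transfer (min j x⊏j)) x′⊏h))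
        where
          transfer : R h ⊏ R j ⊎ R j ≈ R h → R′ h ⊏ R′ j ⊎ R′ j ≈ R′ h
          transfer (inj₁ h⊏j) = inj₁ (to (⊏-iff h j) h⊏j)
          transfer (inj₂ j≈h) = inj₂ (to (≈-iff j h) j≈h)
      decide : R j ⊏ x ⊎ R j ≈ x ⊎ x ⊏ R j → R j ⊏ x
      decide (inj₁ j⊏x) = j⊏x
      decide (inj₂ (inj₁ j≈x)) = ⊥-elim (fresh j (≈-sym j≈x))
      decide (inj₂ (inj₂ x⊏j)) = ⊥-elim (no-entry-between hi least x′⊏hi x⊏j)

  fresh-transfer : ∀ {x x′} → Dom x → Dom x′ → Fresh R x →
                   (∀ j → R j ⊏ x → R′ j ⊏ x′) → (∀ j → x ⊏ R j → x′ ⊏ R′ j) → Fresh R′ x′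
  fresh-transfer {x} dx dx′ fresh below above j x′≈j =
    Stable-⊥ (¬¬-map decide (⊏-trichotomous (from (Dom-iff j) (Dom-resp-≈ x′≈j dx′)) dx))
    where
      decide : R j ⊏ x ⊎ R j ≈ x ⊎ x ⊏ R j → ⊥
      decide (inj₁ j⊏x) = ⊏-irrefl (⊏-resp-≈ ≈-refl x′≈j (below j j⊏x))
      decide (inj₂ (inj₁ j≈x)) = fresh j (≈-sym j≈x)
      decide (inj₂ (inj₂ x⊏j)) = ⊏-irrefl (⊏-resp-≈ x′≈j ≈-refl (above j x⊏j))

  interval : ∀ {x} → Dom x → ∀ lo → IsGreatestBelow x lo → ∀ hi → IsLeastAbove x hi →
             ¬ ¬ ∃₂ λ u v → u ⊏ v × (∀ z → u ⊏ z → z ⊏ v → Above′ z lo × Below′ z hi)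
  interval dx (just l) (l⊏x , _) (just h) (x⊏h , _) =
    pure (R′ l , R′ h , to (⊏-iff l h) (⊏-trans l⊏x x⊏h) , λ _ l⊏z z⊏h → l⊏z , z⊏h)
  interval dx (just l) (l⊏x , _) nothing _ =
    ¬¬-map (λ (v , l⊏v) → R′ l , v , l⊏v , λ _ l⊏z _ → l⊏z , tt) (noMax (to (Dom-iff l) (proj₁ (⊏-dom l⊏x))))
  interval dx nothing _ (just h) (x⊏h , _) =
    ¬¬-map (λ (u , u⊏h) → u , R′ h , u⊏h , λ _ _ z⊏h → tt , z⊏h) (noMin (to (Dom-iff h) (proj₂ (⊏-dom x⊏h))))
  interval {x} dx nothing _ nothing _ =
    ¬¬-map (λ (v , x⊏v) → x , v , x⊏v , λ _ _ _ → tt , tt) (noMax dx)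

module Cuts {_⊏_ : C → C → Set} {Dom : C → Set} (O : UnboundedOrder _⊏_ Dom)
    {I : Set} (R R′ : I → C)
    (≈-iff : ∀ i j → R i ≈ R j ⇔ R′ i ≈ R′ j)
    (⊏-iff : ∀ i j → R i ⊏ R j ⇔ R′ i ⊏ R′ j)
    (Dom-iff : ∀ i → Dom (R i) ⇔ Dom (R′ i)) where
  private
    module L = LowerCuts O R R′ ≈-iff ⊏-iff Dom-iff
    module U = LowerCuts (reverse O) R R′ ≈-iff (λ i j → ⊏-iff j i) Dom-iff

  record Cut (x : C) : Set where
    constructor cut
    field
      lower : Maybe I
      lower-greatest : Below.IsGreatestBelow O R x lower
      upper : Maybe I
      upper-least : Below.IsGreatestBelow (reverse O) R x upper

  cutOf : Listable I → ∀ x → ¬ ¬ Cut x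
  cutOf en x = Below.greatestBelow O R en x >>= λ (lo , l) →
               ¬¬-map (λ (hi , h) → cut lo l hi h) (Below.greatestBelow (reverse O) R en x)

  InCut′ : ∀ {x} → Cut x → C → Set
  InCut′ (cut lo _ hi _) x′ = L.Above′ x′ lo × L.Below′ x′ hi

  cut-interval : ∀ {x} → Dom x → (c : Cut x) →
                 ¬ ¬ ∃₂ λ u v → u ⊏ v × (∀ z → u ⊏ z → z ⊏ v → InCut′ c z)
  cut-interval dx (cut lo l hi h) = L.interval dx lo l hi h

  record SamePosition (x x′ : C) : Set where
    field
      below-iff : ∀ j → R j ⊏ x ⇔ R′ j ⊏ x′
      above-iff : ∀ j → x ⊏ R j ⇔ x′ ⊏ R′ j
      fresh′ : Fresh R′ x′

  InCut′⇒SamePosition : ∀ {x x′} → Dom x → Dom x′ → Fresh R x → (c : Cut x) → InCut′ c x′ →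
                        SamePosition x x′
  InCut′⇒SamePosition {x} {x′} dx dx′ fresh (cut lo l hi h) (above , below) = record
    { below-iff = λ j → mk⇔ (L.below-to lo l above j) (L.below-from dx fresh hi h below j)
    ; above-iff = λ j → mk⇔ (U.below-to hi h (flip-upper hi below) j)
                            (U.below-from dx fresh lo (flip-lower lo l) (flip-lower′ lo above) j)
    ; fresh′ = L.fresh-transfer dx dx′ fresh (L.below-to lo l above) (U.below-to hi h (flip-upper hi below))
    }
    where
      flip-upper : ∀ hi → L.Below′ x′ hi → U.Above′ x′ hi
      flip-upper (just _) b = b
      flip-upper nothing b = b
      flip-lower′ : ∀ lo → L.Above′ x′ lo → U.Below′ x′ lo
      flip-lower′ (just _) a = a
      flip-lower′ nothing a = a
      flip-lower : ∀ lo → Below.IsGreatestBelow O R x lo → Below.IsGreatestBelow (reverse (reverse O)) R x lo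
      flip-lower (just _) g = g
      flip-lower nothing g = g

-- Counting

encode : ∀ {W} (xs : List I) → (I → Fin W) → Fin (W ^ length xs)
encode [] c = zero
encode (x ∷ xs) c = combine (c x) (encode xs c)

encode-injective : ∀ {W} (xs : List I) (c c′ : I → Fin W) → encode xs c ≡ encode xs c′ →
                   ∀ x → x ∈ xs → c x ≡ c′ x
encode-injective (y ∷ xs) c c′ e x (here refl) = combine-injectiveˡ (c y) _ (c′ y) _ e
encode-injective (y ∷ xs) c c′ e x (there x∈xs) =
  encode-injective xs c c′ (combine-injectiveʳ (c y) _ (c′ y) _ e) x x∈xs

functions-collide : ∀ {W X} (en : Listable I) → W ^ length (proj₁ en) < X → (c : Fin X → I → Fin W) →
                    ∃₂ λ s t → s Fin.< t × (∀ x → c s x ≡ c t x)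
functions-collide (xs , ∈xs) bound c with pigeonhole bound (λ s → encode xs (c s))
... | s , t , s<t , e = s , t , s<t , λ x → encode-injective xs (c s) (c t) e x (∈xs x)

isOne : Fin 2 → Bool
isOne zero = false
isOne (suc _) = true

isOne-injective : ∀ {b c} → isOne b ≡ isOne c → b ≡ c
isOne-injective {zero} {zero} _ = refl
isOne-injective {suc zero} {suc zero} _ = refl

fromBool : Bool → Fin 2
fromBool false = zero
fromBool true = suc zero

fromBool-injective : ∀ {b c} → fromBool b ≡ fromBool c → b ≡ c
fromBool-injective {false} {false} _ = refl
fromBool-injective {true} {true} _ = refl

≡true-⇔⇒≡ : ∀ {b c} → b ≡ true ⇔ c ≡ true → b ≡ c
≡true-⇔⇒≡ {true} e = sym (to e refl)
≡true-⇔⇒≡ {false} {false} e = refl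
≡true-⇔⇒≡ {false} {true} e = from e refl

bit : ∀ N → Fin (2 ^ N) → ℕ → Bool
bit zero z i = false
bit (suc N) z zero = isOne (proj₁ (remQuot {2} (2 ^ N) z))
bit (suc N) z (suc i) = bit N (proj₂ (remQuot {2} (2 ^ N) z)) i

bit-injective : ∀ N (z z′ : Fin (2 ^ N)) → (∀ i → i < N → bit N z i ≡ bit N z′ i) → z ≡ z′
bit-injective zero zero zero _ = refl
bit-injective (suc N) z z′ same = begin
  z                                      ≡⟨ combine-remQuot {2} (2 ^ N) z ⟨
  uncurry combine (remQuot {2} (2 ^ N) z)    ≡⟨ cong (uncurry combine) (cong₂ _,_ leading rest) ⟩
  uncurry combine (remQuot {2} (2 ^ N) z′)   ≡⟨ combine-remQuot {2} (2 ^ N) z′ ⟩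
  z′                                     ∎
  where
    open ≡-Reasoning
    leading = isOne-injective (same zero (s≤s z≤n))
    rest = bit-injective N _ _ (λ i i<N → same (suc i) (s≤s i<N))

n<2^n : ∀ n → n < 2 ^ n
n<2^n zero = s≤s z≤n
n<2^n (suc n) = begin-strict
  suc n           ≤⟨ n<2^n n ⟩
  2 ^ n           <⟨ m<m+n (2 ^ n) (m^n>0 2 n) ⟩
  2 ^ n + 2 ^ n   ≡⟨ cong (2 ^ n +_) (+-identityʳ (2 ^ n)) ⟨
  2 ^ suc n       ∎
  where open ≤-Reasoning

a*[4+4a]<2^[4+4a] : ∀ a → a * (4 + 4 * a) < 2 ^ (4 + 4 * a)
a*[4+4a]<2^[4+4a] a = begin-strict
  a * (4 + 4 * a)                ≤⟨ m≤m+n (a * (4 + 4 * a)) (4 + 4 * a) ⟩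
  a * (4 + 4 * a) + (4 + 4 * a)  ≡⟨ solve 1 (λ a → a :* (con 4 :+ con 4 :* a) :+ (con 4 :+ con 4 :* a)
                                                  := (con 2 :* a :+ con 2) :* (con 2 :* a :+ con 2)) refl a ⟩
  u * u                          <⟨ *-mono-< (n<2^n u) (n<2^n u) ⟩
  2 ^ u * 2 ^ u                  ≡⟨ ^-distribˡ-+-* 2 u u ⟨
  2 ^ (u + u)                    ≡⟨ cong (2 ^_) (solve 1 (λ a → (con 2 :* a :+ con 2) :+ (con 2 :* a :+ con 2)
                                                               := con 4 :+ con 4 :* a) refl a) ⟩
  2 ^ (4 + 4 * a)                ∎
  where
    open ≤-Reasoning
    open +-*-Solver
    u = 2 * a + 2

-- N = 2 ^ t with t = 4 + 4 a, a = r + b r and b = c + d + 1 works: (N c + d) ^ r ≤ 2 ^ ((t + b) r) and (t + b) r ≤ t a.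
polynomial<exponential : ∀ c d r → ∃ λ N → (N * c + d) ^ r < 2 ^ N
polynomial<exponential c d r = N , (begin-strict
  (N * c + d) ^ r       ≤⟨ ^-monoˡ-≤ r NB-bound ⟩
  (N * b) ^ r           ≤⟨ ^-monoˡ-≤ r (*-monoʳ-≤ N (<⇒≤ (n<2^n b))) ⟩
  (N * 2 ^ b) ^ r       ≡⟨ cong (_^ r) (^-distribˡ-+-* 2 t b) ⟨
  (2 ^ (t + b)) ^ r     ≡⟨ ^-*-assoc 2 (t + b) r ⟩
  2 ^ ((t + b) * r)     <⟨ ^-monoʳ-< 2 (s≤s (s≤s z≤n)) exponent-bound ⟩
  2 ^ N                 ∎)
  where
    open ≤-Reasoning
    open +-*-Solver
    b = c + d + 1
    a = r + b * r
    t = 4 + 4 * a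
    N = 2 ^ t
    NB-bound : N * c + d ≤ N * b
    NB-bound = begin
      N * c + d           ≤⟨ +-monoʳ-≤ (N * c) (m≤n*m d N {{m^n≢0 2 t}}) ⟩
      N * c + N * d       ≤⟨ m≤m+n (N * c + N * d) N ⟩
      N * c + N * d + N   ≡⟨ solve 3 (λ N c d → N :* c :+ N :* d :+ N := N :* (c :+ d :+ con 1)) refl N c d ⟩
      N * b               ∎
    exponent-bound : (t + b) * r < N
    exponent-bound = begin-strict
      (t + b) * r           ≡⟨ *-distribʳ-+ r t b ⟩
      t * r + b * r         ≤⟨ +-monoʳ-≤ (t * r) (m≤n*m (b * r) t) ⟩
      t * r + t * (b * r)   ≡⟨ *-distribˡ-+ t r (b * r) ⟨
      t * a                 ≡⟨ *-comm t a ⟩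
      a * t                 <⟨ a*[4+4a]<2^[4+4a] a ⟩
      N                     ∎

∷-≗ : ∀ {k} {ρ ρ′ : Vector X k} a → ρ ≗ ρ′ → (a ∷ᵥ ρ) ≗ (a ∷ᵥ ρ′)
∷-≗ a e zero = refl
∷-≗ a e (suc i) = e i

module _ {n : ℕ} (M : Structure n) where

  Sat-stable : ∀ {k} (φ : Formula n k) ρ → Stable (Sat M φ ρ)
  Sat-stable ⊥'           ρ = Stable-⊥
  Sat-stable (t ≐ u)      ρ = negated-stable
  Sat-stable (P' m p t)   ρ = negated-stable
  Sat-stable (Q' m p t)   ρ = negated-stable
  Sat-stable (L' m p t u) ρ = negated-stable
  Sat-stable (φ ∧' ψ)     ρ = Stable-× (Sat-stable φ ρ) (Sat-stable ψ ρ)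
  Sat-stable (φ ∨' ψ)     ρ = negated-stable
  Sat-stable (φ ⇒' ψ)     ρ = Stable-Π (λ _ → Sat-stable ψ ρ)
  Sat-stable (∀' φ)       ρ = Stable-Π (λ a → Sat-stable φ (a ∷ᵥ ρ))
  Sat-stable (∃' φ)       ρ = negated-stable

  evalT-cong : ∀ {k} {ρ ρ′ : Vector (Carrier M) k} → ρ ≗ ρ′ → ∀ t → evalT M ρ t ≡ evalT M ρ′ t
  evalT-cong e (var i)    = e i
  evalT-cong e (fn m q t) = cong (fᴹ M m q) (evalT-cong e t)

  Sat-cong : ∀ {k} (φ : Formula n k) {ρ ρ′ : Vector (Carrier M) k} → ρ ≗ ρ′ → Sat M φ ρ → Sat M φ ρ′
  Sat-cong ⊥'           e s = s
  Sat-cong (t ≐ u)      e s = ¬¬-map (λ t≡u → trans (sym (evalT-cong e t)) (trans t≡u (evalT-cong e u))) s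
  Sat-cong (P' m p t)   e s = ¬¬-map (subst (Pᴹ M m p) (evalT-cong e t)) s
  Sat-cong (Q' m p t)   e s = ¬¬-map (subst (Qᴹ M m p) (evalT-cong e t)) s
  Sat-cong (L' m p t u) e s = ¬¬-map (subst₂ (Lᴹ M m p) (evalT-cong e t) (evalT-cong e u)) s
  Sat-cong (φ ∧' ψ)     e (s , s′) = Sat-cong φ e s , Sat-cong ψ e s′
  Sat-cong (φ ∨' ψ)     e s (¬φ , ¬ψ) = s ((¬φ ∘ Sat-cong φ e) , (¬ψ ∘ Sat-cong ψ e))
  Sat-cong (φ ⇒' ψ)     e s = Sat-cong ψ e ∘ s ∘ Sat-cong φ (sym ∘ e)
  Sat-cong (∀' φ)       e s a = Sat-cong φ (∷-≗ a e) (s a)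
  Sat-cong (∃' φ)       e s ¬∃ = s (λ a → ¬∃ a ∘ Sat-cong φ (∷-≗ a e))

  Sat-bigOr : ∀ {k} {ρ : Vector (Carrier M) k} j (F : (m : ℕ) → m < j → Formula n k) →
              Sat M (bigOr j F) ρ → ¬ ¬ (∃ λ m → Σ (m < j) λ p → Sat M (F m p) ρ)
  Sat-bigOr zero    F ()
  Sat-bigOr (suc j) F s ¬∃ = s ((λ s′ → Sat-bigOr j _ s′ λ (m , p , sm) → ¬∃ (m , m<n⇒m<1+n p , sm))
                              , (λ sj → ¬∃ (j , n<1+n j , sj)))

module Model {n : ℕ} (M : Structure n) (isM : IsModel M) where

  U : Set
  U = Carrier M

  P Q : (m : ℕ) → m < n → U → Set
  P m p x = ¬ ¬ Pᴹ M m p x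
  Q m p x = ¬ ¬ Qᴹ M m p x

  Lt : (m : ℕ) → m < n → U → U → Set
  Lt m p x y = ¬ ¬ Lᴹ M m p x y

  Q∖P : (m : ℕ) → m < n → U → Set
  Q∖P m p x = Q m p x × ¬ P m p x

  f : (m : ℕ) → suc m < n → U → U
  f = fᴹ M

  -- the proof term Defs uses, so that the axioms about f_m apply without transport
  suc<⇒< : ∀ {m} → suc m < n → m < n
  suc<⇒< {m} q = <-trans (n<1+n m) q

  P-irr : ∀ {m} {p p′ : m < n} {x} → P m p x → P m p′ x
  P-irr {p = p} {p′} = subst (λ p → P _ p _) (<-irrelevant p p′)

  Q-irr : ∀ {m} {p p′ : m < n} {x} → Q m p x → Q m p′ x
  Q-irr {p = p} {p′} = subst (λ p → Q _ p _) (<-irrelevant p p′)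

  Lt-irr : ∀ {m} {p p′ : m < n} {x y} → Lt m p x y → Lt m p′ x y
  Lt-irr {p = p} {p′} = subst (λ p → Lt _ p _ _) (<-irrelevant p p′)

  f-irr : ∀ {m} {q q′ : suc m < n} {x} → f m q x ≡ f m q′ x
  f-irr {q = q} {q′} = cong (λ q → f _ q _) (<-irrelevant q q′)

  hasSort : ∀ x → ¬ ¬ ∃ λ m → Σ (m < n) λ p → Q m p x
  hasSort x = Sat-bigOr M n _ (isM cover x)

  Q-unique : ∀ {m m′} {p : m < n} {p′ : m′ < n} {x} → Q m p x → Q m′ p′ x → m ≡ m′
  Q-unique {m} {m′} {p} {p′} qx qx′ with m ≟ m′
  ... | yes m≡m′ = m≡m′
  ... | no m≢m′ = ⊥-elim (isM (disjoint m m′ p p′ m≢m′) _ (qx , qx′))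

  Lt-sorted : ∀ {m} (p : m < n) {x y} → Lt m p x y → Q m p x × Q m p y
  Lt-sorted p = isM (lt-dom _ p) _ _

  Lt-irrefl : ∀ {m} (p : m < n) {x} → ¬ Lt m p x x
  Lt-irrefl p = isM (lt-irrefl _ p) _

  P⊆Q : ∀ {m} (p : m < n) {x} → P m p x → Q m p x
  P⊆Q p = isM (P-sub _ p) _

  order : ∀ m (p : m < n) → UnboundedOrder (Lt m p) (Q m p)
  order m p = record
    { ⊏-stable = negated-stable
    ; Dom-stable = negated-stable
    ; ⊏-trans = λ x<y y<z → isM (lt-trans m p) _ _ _ (x<y , y<z)
    ; ⊏-irrefl = Lt-irrefl p
    ; ⊏-dom = Lt-sorted p
    ; ⊏-trichotomous = λ qx qy ¬tri → isM (lt-total m p) _ _ (qx , qy)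
        ((¬tri ∘ inj₁) , λ ¬rest → ¬rest ((¬tri ∘ inj₂ ∘ inj₁) , (¬tri ∘ inj₂ ∘ inj₂)))
    ; noMax = λ qx ¬max → isM (lt-nomax m p) _ qx λ z x<z → ¬max (z , x<z)
    ; noMin = λ qx ¬min → isM (lt-nomin m p) _ qx λ z z<x → ¬min (z , z<x)
    }

  P-between : ∀ {m} (p : m < n) {x y} → Lt m p x y → ¬ ¬ ∃ λ z → P m p z × Lt m p x z × Lt m p z y
  P-between p x<y ¬∃ = isM (P-dense _ p) _ _ x<y (λ z h → ¬∃ (z , h))

  ¬P-between : ∀ {m} (p : m < n) {x y} → Lt m p x y → ¬ ¬ ∃ λ z → ¬ P m p z × Lt m p x z × Lt m p z y
  ¬P-between p x<y ¬∃ = isM (P-codense _ p) _ _ x<y (λ z h → ¬∃ (z , h))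

  f-P : ∀ {m} (q : suc m < n) {x} → P (suc m) q x → Q∖P m (suc<⇒< q) (f m q x)
  f-P q = isM (f-to _ q) _

  f-Q∖P : ∀ {m} (q : suc m < n) {x} → Q∖P m (suc<⇒< q) x → P (suc m) q (f m q x)
  f-Q∖P q = isM (f-from _ q) _

  f-involutive : ∀ {m} (q : suc m < n) {x} → f m q (f m q x) ≈ x
  f-involutive q = isM (f-invol _ q) _

  f-extension : ∀ {m} (q : suc m < n) {a₁ c₁ a₂ c₂} → Lt m (suc<⇒< q) a₁ c₁ → Lt (suc m) q a₂ c₂ →
    ¬ ¬ ∃₂ λ b₁ b₂ → Q∖P m (suc<⇒< q) b₁ × P (suc m) q b₂ ×
                     (Lt m (suc<⇒< q) a₁ b₁ × Lt m (suc<⇒< q) b₁ c₁) ×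
                     (Lt (suc m) q a₂ b₂ × Lt (suc m) q b₂ c₂) ×
                     f m q b₂ ≈ b₁
  f-extension q a₁<c₁ a₂<c₂ ¬∃ =
    isM (f-ext _ q) _ _ _ _ (a₁<c₁ , a₂<c₂) λ b₁ h → h λ b₂ h′ → ¬∃ (b₁ , b₂ , h′)

  f-fixes : ∀ {m} {p : m < n} {x} → Q m p x → ∀ k (q : suc k < n) →
            (suc k ≡ m → ¬ P m p x) → (k ≡ m → P m p x) → f k q x ≈ x
  f-fixes {p = p} qx k q ¬moved-up ¬moved-down = isM (f-id k q) _ (notP , notQ∖P)
    where
      notP : ¬ P (suc k) q _
      notP px with refl ← Q-unique (P⊆Q q px) qx = ¬moved-up refl (P-irr px)
      notQ∖P : ¬ Q∖P k (suc<⇒< q) _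
      notQ∖P (qx′ , ¬px) with refl ← Q-unique qx′ qx = ¬px (P-irr (¬moved-down refl))

  Action : Set → Set
  Action I = (k : ℕ) → suc k < n → I → I

  -- g records how the function symbols act on the indices of R
  Closed : Action I → (I → U) → Set
  Closed g R = ∀ k q i → f k q (R i) ≈ R (g k q i)

  _⊕_ : Action I → Action J → Action (I ⊎ J)
  (g ⊕ h) k q = Sum.map (g k q) (h k q)

  Closed-⊎ : {g : Action I} {h : Action J} {R : I → U} {S : J → U} → Closed g R → Closed h S → Closed (g ⊕ h) [ R , S ]
  Closed-⊎ cR cS k q (inj₁ i) = cR k q i
  Closed-⊎ cR cS k q (inj₂ j) = cS k q j

  Closed-resp : {g h : Action I} {R : I → U} → (∀ k q i → g k q i ≡ h k q i) → Closed h R → Closed g R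
  Closed-resp {R = R} g≡h closed k q i = subst (λ j → f k q (R i) ≈ R j) (sym (g≡h k q i)) (closed k q i)

  record SameDiagram (R R′ : I → U) : Set where
    field
      ≈-iff  : ∀ i j → R i ≈ R j ⇔ R′ i ≈ R′ j
      P-iff  : ∀ m p i → P m p (R i) ⇔ P m p (R′ i)
      Q-iff  : ∀ m p i → Q m p (R i) ⇔ Q m p (R′ i)
      Lt-iff : ∀ m p i j → Lt m p (R i) (R j) ⇔ Lt m p (R′ i) (R′ j)

  module SD = SameDiagram

  SameDiagram-refl : (R : I → U) → SameDiagram R R
  SameDiagram-refl R = record { ≈-iff = λ _ _ → ⇔-id _ ; P-iff = λ _ _ _ → ⇔-id _ ; Q-iff = λ _ _ _ → ⇔-id _
                              ; Lt-iff = λ _ _ _ _ → ⇔-id _ }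

  SameDiagram-sym : {R R′ : I → U} → SameDiagram R R′ → SameDiagram R′ R
  SameDiagram-sym E = record
    { ≈-iff = λ i j → ⇔-sym (SD.≈-iff E i j) ; P-iff = λ m p i → ⇔-sym (SD.P-iff E m p i)
    ; Q-iff = λ m p i → ⇔-sym (SD.Q-iff E m p i) ; Lt-iff = λ m p i j → ⇔-sym (SD.Lt-iff E m p i j) }

  SameDiagram-reindex : {R R′ : I → U} {S S′ : J → U} (π : J → I) → SameDiagram R R′ →
                        (∀ j → R (π j) ≈ S j) → (∀ j → R′ (π j) ≈ S′ j) → SameDiagram S S′
  SameDiagram-reindex π E e e′ = record
    { ≈-iff = λ i j → ⇔-resp-≈₂ _≡_ (e i) (e j) (e′ i) (e′ j) (SD.≈-iff E (π i) (π j))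
    ; P-iff = λ m p i → ⇔-resp-≈ (Pᴹ M m p) (e i) (e′ i) (SD.P-iff E m p (π i))
    ; Q-iff = λ m p i → ⇔-resp-≈ (Qᴹ M m p) (e i) (e′ i) (SD.Q-iff E m p (π i))
    ; Lt-iff = λ m p i j → ⇔-resp-≈₂ (Lᴹ M m p) (e i) (e j) (e′ i) (e′ j) (SD.Lt-iff E m p (π i) (π j))
    }

  record SameCross (R : I → U) (S : J → U) (R′ : I → U) (S′ : J → U) : Set where
    field
      ≈-iff : ∀ i j → R i ≈ S j ⇔ R′ i ≈ S′ j
      <-iff : ∀ m p i j → Lt m p (R i) (S j) ⇔ Lt m p (R′ i) (S′ j)
      >-iff : ∀ m p i j → Lt m p (S j) (R i) ⇔ Lt m p (S′ j) (R′ i)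

  module SC = SameCross

  SameDiagram-⊎ : {R R′ : I → U} {S S′ : J → U} → SameDiagram R R′ → SameDiagram S S′ → SameCross R S R′ S′ →
                  SameDiagram [ R , S ] [ R′ , S′ ]
  SameDiagram-⊎ ER ES cross = record { ≈-iff = ≈-iff ; P-iff = P-iff ; Q-iff = Q-iff ; Lt-iff = Lt-iff }
    where
      ≈-iff : ∀ i j → _
      ≈-iff (inj₁ i) (inj₁ j) = SD.≈-iff ER i j
      ≈-iff (inj₁ i) (inj₂ j) = SC.≈-iff cross i j
      ≈-iff (inj₂ i) (inj₁ j) = ≈-sym-⇔ (SC.≈-iff cross j i)
      ≈-iff (inj₂ i) (inj₂ j) = SD.≈-iff ES i j
      P-iff : ∀ m p i → _
      P-iff m p (inj₁ i) = SD.P-iff ER m p i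
      P-iff m p (inj₂ i) = SD.P-iff ES m p i
      Q-iff : ∀ m p i → _
      Q-iff m p (inj₁ i) = SD.Q-iff ER m p i
      Q-iff m p (inj₂ i) = SD.Q-iff ES m p i
      Lt-iff : ∀ m p i j → _
      Lt-iff m p (inj₁ i) (inj₁ j) = SD.Lt-iff ER m p i j
      Lt-iff m p (inj₁ i) (inj₂ j) = SC.<-iff cross m p i j
      Lt-iff m p (inj₂ i) (inj₁ j) = SC.>-iff cross m p j i
      Lt-iff m p (inj₂ i) (inj₂ j) = SD.Lt-iff ES m p i j

  record Matching (g : Action I) (R R′ : I → U) : Set where
    field
      closed  : Closed g R
      closed′ : Closed g R′
      same    : SameDiagram R R′

  Matching-sym : {g : Action I} {R R′ : I → U} → Matching g R R′ → Matching g R′ R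
  Matching-sym m = record { closed = closed′ ; closed′ = closed ; same = SameDiagram-sym same }
    where open Matching m

  unequal-sorts-≉ : ∀ {m m′} {p : m < n} {p′ : m′ < n} {x y} → m ≢ m′ → Q m p x → Q m′ p′ y → ¬ x ≈ y
  unequal-sorts-≉ {p′ = p′} m≢m′ qx qy x≈y = m≢m′ (Q-unique qx (≈-subst (Qᴹ M _ p′) (≈-sym x≈y) qy))

  unequal-sorts-≮ : ∀ {m m′} {p : m < n} {p′ : m′ < n} {x y} → m ≢ m′ → Q m p x → Q m′ p′ y →
                    ∀ k (pk : k < n) → ¬ Lt k pk x y
  unequal-sorts-≮ m≢m′ qx qy k pk x<y =
    m≢m′ (trans (Q-unique qx (proj₁ (Lt-sorted pk x<y))) (Q-unique (proj₂ (Lt-sorted pk x<y)) qy))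

  record SameKind (x x′ : U) : Set where
    field
      P-iff : ∀ m p → P m p x ⇔ P m p x′
      Q-iff : ∀ m p → Q m p x ⇔ Q m p x′

  SameKind-intro : ∀ {m} {p : m < n} {x x′} → Q m p x → Q m p x′ → P m p x ⇔ P m p x′ → SameKind x x′
  SameKind-intro {m} qx qx′ px⇔px′ = record { P-iff = P-iff ; Q-iff = Q-iff }
    where
      P-iff : ∀ k pk → P k pk _ ⇔ P k pk _
      P-iff k pk with k ≟ m
      ... | yes refl = mk⇔ (P-irr ∘ to px⇔px′ ∘ P-irr) (P-irr ∘ from px⇔px′ ∘ P-irr)
      ... | no k≢m = both-false (λ px → k≢m (Q-unique (P⊆Q pk px) qx))
                                (λ px′ → k≢m (Q-unique (P⊆Q pk px′) qx′))
      Q-iff : ∀ k pk → Q k pk _ ⇔ Q k pk _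
      Q-iff k pk with k ≟ m
      ... | yes refl = both-true (Q-irr qx) (Q-irr qx′)
      ... | no k≢m = both-false (λ qy → k≢m (Q-unique qy qx)) (λ qy′ → k≢m (Q-unique qy′ qx′))

  pair : U → U → Bool → U
  pair a b t = if t then a else b

  pair-diagonal : ∀ x t → pair x x t ≡ x
  pair-diagonal x true = refl
  pair-diagonal x false = refl

  SameDiagram-pair-diagonal : ∀ {a a′} → SameKind a a′ → SameDiagram (pair a a) (pair a′ a′)
  SameDiagram-pair-diagonal K = record
    { ≈-iff = λ t t′ → both-true (diagonal t t′) (diagonal t t′)
    ; P-iff = λ m p t → cases {F = P m p} t (SameKind.P-iff K m p)
    ; Q-iff = λ m p t → cases {F = Q m p} t (SameKind.Q-iff K m p)
    ; Lt-iff = λ m p t t′ → both-false (irreflexive t t′) (irreflexive t t′)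
    }
    where
      diagonal : ∀ {x} t t′ → pair x x t ≈ pair x x t′
      diagonal {x} t t′ = pure (trans (pair-diagonal x t) (sym (pair-diagonal x t′)))
      irreflexive : ∀ {x m} {p : m < n} t t′ → ¬ Lt m p (pair x x t) (pair x x t′)
      irreflexive {p = p} t t′ x<x = Lt-irrefl p (≈-subst₂ (Lᴹ M _ p) ≈-refl (≈-sym (diagonal t t′)) x<x)
      cases : ∀ {F : U → Set} {x x′} t → F x ⇔ F x′ → F (pair x x t) ⇔ F (pair x′ x′ t)
      cases true e = e
      cases false e = e

  SameDiagram-pair-sorted : ∀ {m m′} {p : m < n} {p′ : m′ < n} {a b a′ b′} → m ≢ m′ →
                            Q m p a → Q m′ p′ b → Q m p a′ → Q m′ p′ b′ → SameKind a a′ → SameKind b b′ →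
                            SameDiagram (pair a b) (pair a′ b′)
  SameDiagram-pair-sorted m≢m′ qa qb qa′ qb′ Ka Kb = record
    { ≈-iff = ≈-iff
    ; P-iff = λ { m p true → SameKind.P-iff Ka m p ; m p false → SameKind.P-iff Kb m p }
    ; Q-iff = λ { m p true → SameKind.Q-iff Ka m p ; m p false → SameKind.Q-iff Kb m p }
    ; Lt-iff = Lt-iff
    }
    where
      ≈-iff : ∀ t t′ → _
      ≈-iff true true = both-true ≈-refl ≈-refl
      ≈-iff false false = both-true ≈-refl ≈-refl
      ≈-iff true false = both-false (unequal-sorts-≉ m≢m′ qa qb) (unequal-sorts-≉ m≢m′ qa′ qb′)
      ≈-iff false true = both-false (unequal-sorts-≉ (m≢m′ ∘ sym) qb qa) (unequal-sorts-≉ (m≢m′ ∘ sym) qb′ qa′)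
      Lt-iff : ∀ k pk t t′ → _
      Lt-iff k pk true true = both-false (Lt-irrefl pk) (Lt-irrefl pk)
      Lt-iff k pk false false = both-false (Lt-irrefl pk) (Lt-irrefl pk)
      Lt-iff k pk true false = both-false (unequal-sorts-≮ m≢m′ qa qb k pk) (unequal-sorts-≮ m≢m′ qa′ qb′ k pk)
      Lt-iff k pk false true =
        both-false (unequal-sorts-≮ (m≢m′ ∘ sym) qb qa k pk) (unequal-sorts-≮ (m≢m′ ∘ sym) qb′ qa′ k pk)

  Lt-irr-⇔ : ∀ {m} {p p′ : m < n} {x y x′ y′} → Lt m p x y ⇔ Lt m p x′ y′ → Lt m p′ x y ⇔ Lt m p′ x′ y′
  Lt-irr-⇔ e = mk⇔ (Lt-irr ∘ to e ∘ Lt-irr) (Lt-irr ∘ from e ∘ Lt-irr)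

  record Position (R R′ : I → U) (x x′ : U) : Set where
    field
      ≈-iff : ∀ j → x ≈ R j ⇔ x′ ≈ R′ j
      <-iff : ∀ m p j → Lt m p x (R j) ⇔ Lt m p x′ (R′ j)
      >-iff : ∀ m p j → Lt m p (R j) x ⇔ Lt m p (R′ j) x′

  module Pos = Position

  SameCross-pair : {R R′ : I → U} {a b a′ b′ : U} → Position R R′ a a′ → Position R R′ b b′ →
                   SameCross (pair a b) R (pair a′ b′) R′
  SameCross-pair pos-a pos-b = record
    { ≈-iff = λ { true → Pos.≈-iff pos-a ; false → Pos.≈-iff pos-b }
    ; <-iff = λ { m p true → Pos.<-iff pos-a m p ; m p false → Pos.<-iff pos-b m p }
    ; >-iff = λ { m p true → Pos.>-iff pos-a m p ; m p false → Pos.>-iff pos-b m p }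
    }

  module CutsAt {I : Set} {R R′ : I → U} (E : SameDiagram R R′) (m : ℕ) (p : m < n) =
    Cuts (order m p) R R′ (SD.≈-iff E) (SD.Lt-iff E m p) (SD.Q-iff E m p)

  cut-position : {R R′ : I → U} (E : SameDiagram R R′) {m : ℕ} (p : m < n) {x x′ : U} →
                 Q m p x → Q m p x′ → Fresh R x →
                 (c : CutsAt.Cut E m p x) → CutsAt.InCut′ E m p c x′ → Position R R′ x x′
  cut-position {R = R} {R′} E {m} p {x} {x′} qx qx′ fresh c x′∈c = record
    { ≈-iff = λ j → both-false (fresh j) (fresh′ j)
    ; <-iff = <-iff
    ; >-iff = >-iff
    }
    where
      open CutsAt.SamePosition E m p (CutsAt.InCut′⇒SamePosition E m p qx qx′ fresh c x′∈c)
      <-iff : ∀ k pk j → Lt k pk x (R j) ⇔ Lt k pk x′ (R′ j)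
      <-iff k pk j with k ≟ m
      ... | yes refl = Lt-irr-⇔ (above-iff j)
      ... | no k≢m = both-false (λ x<y → k≢m (Q-unique (proj₁ (Lt-sorted pk x<y)) qx))
                                (λ x′<y′ → k≢m (Q-unique (proj₁ (Lt-sorted pk x′<y′)) qx′))
      >-iff : ∀ k pk j → Lt k pk (R j) x ⇔ Lt k pk (R′ j) x′
      >-iff k pk j with k ≟ m
      ... | yes refl = Lt-irr-⇔ (below-iff j)
      ... | no k≢m = both-false (λ y<x → k≢m (Q-unique (proj₂ (Lt-sorted pk y<x)) qx))
                                (λ y′<x′ → k≢m (Q-unique (proj₂ (Lt-sorted pk y′<x′)) qx′))

  fixed-pair-closed : ∀ {x} → (∀ k q → f k q x ≈ x) → (g : Action Bool) → Closed g (pair x x)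
  fixed-pair-closed {x} fixed g k q t =
    subst₂ (λ y z → f k q y ≈ z) (sym (pair-diagonal x t)) (sym (pair-diagonal x (g k q t))) (fixed k q)

  swapAt : ℕ → Action Bool
  swapAt m k _ t with k ≟ m
  ... | yes _ = not t
  ... | no _ = t

  module SwappedPair {m} (q : suc m < n) {u v} (u∈ : Q∖P m (suc<⇒< q) u) (v∈ : P (suc m) q v)
                     (fv≈u : f m q v ≈ u) where

    moved : ∀ {k} (q′ : suc k < n) → k ≡ m → f k q′ u ≈ v × f k q′ v ≈ u
    moved q′ refl = ≈-trans (pure f-irr) (≈-trans (≈-cong (f _ q) (≈-sym fv≈u)) (f-involutive q))
                  , ≈-trans (pure f-irr) fv≈u

    fixed : ∀ {k} (q′ : suc k < n) → k ≢ m → f k q′ u ≈ u × f k q′ v ≈ v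
    fixed {k} q′ k≢m = f-fixes (proj₁ u∈) k q′ (λ _ → proj₂ u∈) (⊥-elim ∘ k≢m)
                     , f-fixes (P⊆Q q v∈) k q′ (⊥-elim ∘ k≢m ∘ suc-injective) (λ _ → v∈)

    closed : Closed (swapAt m) (pair u v)
    closed k q′ t with k ≟ m
    closed k q′ true  | yes k≡m = proj₁ (moved q′ k≡m)
    closed k q′ false | yes k≡m = proj₂ (moved q′ k≡m)
    closed k q′ true  | no k≢m = proj₁ (fixed q′ k≢m)
    closed k q′ false | no k≢m = proj₂ (fixed q′ k≢m)

    closed′ : Closed (swapAt m) (pair v u)
    closed′ k q′ t with k ≟ m
    closed′ k q′ true  | yes k≡m = proj₂ (moved q′ k≡m)
    closed′ k q′ false | yes k≡m = proj₁ (moved q′ k≡m)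
    closed′ k q′ true  | no k≢m = proj₂ (fixed q′ k≢m)
    closed′ k q′ false | no k≢m = proj₁ (fixed q′ k≢m)

  Fresh-f : {g : Action I} {R : I → U} → Closed g R → ∀ {a} k q → Fresh R a → Fresh R (f k q a)
  Fresh-f {g = g} closed k q fresh j fa≈j =
    fresh (g k q j) (≈-trans (≈-sym (f-involutive q)) (≈-trans (≈-cong (f k q) fa≈j) (closed k q j)))

  record Kind (x : U) : Set where
    constructor kind
    field
      sort   : ℕ
      sort<n : sort < n
      inQ    : Q sort sort<n x
      inP    : Bool
      P-bit  : if inP then P sort sort<n x else ¬ P sort sort<n x

  kindOf : ∀ x → ¬ ¬ Kind x
  kindOf x = hasSort x >>= λ (m , p , qx) → ¬¬-map (λ where
    (yes px) → kind m p qx true px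
    (no ¬px) → kind m p qx false ¬px) ¬¬-excluded-middle

  ¬P-partner : ∀ {m} → Dec (suc m < n) → U → U
  ¬P-partner {m} (yes q) x = f m q x
  ¬P-partner (no _) x = x

  -- Each element has a partner such that the two together are closed under all f_k.
  partner : ∀ {x} → Kind x → U
  partner {x} (kind m _ _ false _) = ¬P-partner (suc m <? n) x
  partner {x} (kind zero _ _ true _) = x
  partner {x} (kind (suc m) q _ true _) = f m q x

  kindAction : ℕ → Bool → Action Bool
  kindAction m       false = swapAt m
  kindAction zero    true  _ _ t = t
  kindAction (suc m) true  = swapAt m

  Kind-closed : ∀ {x} (K : Kind x) → Closed (kindAction (Kind.sort K) (Kind.inP K)) (pair x (partner K))
  Kind-closed (kind zero p qx true px) = fixed-pair-closed (λ k q → f-fixes qx k q (λ ()) (λ _ → px)) _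
  Kind-closed (kind (suc m) q qx true px) = SwappedPair.closed′ q (f-P q px) px ≈-refl
  Kind-closed {x} (kind m p qx false ¬px) = closed (suc m <? n)
    where
      closed : (d : Dec (suc m < n)) → Closed (swapAt m) (pair x (¬P-partner d x))
      closed (yes q) = SwappedPair.closed q x∈ (f-Q∖P q x∈) (f-involutive q)
        where x∈ = Q-irr qx , ¬px ∘ P-irr
      closed (no ¬q) = fixed-pair-closed (λ k q′ → f-fixes qx k q′ (λ _ → ¬px) (λ { refl → ⊥-elim (¬q q′) })) _

  -- Back and forth

  record Extension (R R′ : I → U) (a : U) : Set where
    constructor extension
    field
      a′ b b′  : U
      action   : Action (Bool ⊎ I)
      matching : Matching action [ pair a b , R ] [ pair a′ b′ , R′ ]

  module _ {I : Set} (en : Listable I) {g : Action I} {R R′ : I → U} (mat : Matching g R R′) where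
    open Matching mat

    extend-present : ∀ {a} j → a ≈ R j → Extension R R′ a
    extend-present {a} j a≈j = extension (R′ j) a (R′ j) action
      (record { closed = closed-π e closed ; closed′ = closed-π e′ closed′ ; same = SameDiagram-reindex π same e e′ })
      where
        π : Bool ⊎ I → I
        π = [ (λ _ → j) , id ]
        action : Action (Bool ⊎ I)
        action k q = inj₂ ∘ g k q ∘ π
        e : ∀ i → R (π i) ≈ [ pair a a , R ] i
        e (inj₁ true) = ≈-sym a≈j
        e (inj₁ false) = ≈-sym a≈j
        e (inj₂ i) = ≈-refl
        e′ : ∀ i → R′ (π i) ≈ [ pair (R′ j) (R′ j) , R′ ] i
        e′ (inj₁ true) = ≈-refl
        e′ (inj₁ false) = ≈-refl
        e′ (inj₂ i) = ≈-refl
        closed-π : {S : I → U} {T : Bool ⊎ I → U} → (∀ i → S (π i) ≈ T i) → Closed g S → Closed action T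
        closed-π eq closedS k q i =
          ≈-trans (≈-cong (f k q) (≈-sym (eq i))) (≈-trans (closedS k q (π i)) (eq (inj₂ (g k q (π i)))))

    extend-fixed : ∀ {m} (p : m < n) {a} → Q m p a → Fresh R a → (S : U → Set) → S a →
                   (∀ {u v} → Lt m p u v → ¬ ¬ ∃ λ z → S z × Lt m p u z × Lt m p z v) →
                   (∀ {y z} → S y → S z → P m p y ⇔ P m p z) →
                   (∀ {z} → Q m p z → S z → ∀ k q → f k q z ≈ z) → ¬ ¬ Extension R R′ a
    extend-fixed {m} p {a} qa fresh S sa S-between S-P S-fixed =
      cutOf en a >>= λ c →
      cut-interval qa c >>= λ (u , v , u<v , inside) →
      ¬¬-map (λ (z , sz , u<z , z<v) → counterpart c z sz (Lt-sorted p u<z .proj₂) (inside z u<z z<v)) (S-between u<v)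
      where
        open CutsAt same m p
        counterpart : (c : Cut a) (z : U) → S z → Q m p z → InCut′ c z → Extension R R′ a
        counterpart c z sz qz z∈c = extension z a z ((λ _ _ t → t) ⊕ g) (record
          { closed = Closed-⊎ (fixed-pair-closed (S-fixed qa sa) _) closed
          ; closed′ = Closed-⊎ (fixed-pair-closed (S-fixed qz sz) _) closed′
          ; same = SameDiagram-⊎ (SameDiagram-pair-diagonal (SameKind-intro qa qz (S-P sa sz))) same
                     (SameCross-pair position position)
          })
          where position = cut-position same p qa qz fresh c z∈c

    extend-pair : ∀ {m} (q : suc m < n) {u v} → Q∖P m (suc<⇒< q) u → P (suc m) q v → f m q v ≈ u →
                  Fresh R u → Fresh R v → ¬ ¬ (Extension R R′ u × Extension R R′ v)
    extend-pair {m} q {u} {v} u∈ v∈ fv≈u fresh-u fresh-v =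
      L.cutOf en u >>= λ cu →
      H.cutOf en v >>= λ cv →
      L.cut-interval (proj₁ u∈) cu >>= λ (_ , _ , l₁ , inside₁) →
      H.cut-interval (P⊆Q q v∈) cv >>= λ (_ , _ , l₂ , inside₂) →
      ¬¬-map (λ (u′ , v′ , u′∈ , v′∈ , (x₁ , y₁) , (x₂ , y₂) , fv′≈u′) →
                 counterparts u′ v′ u′∈ v′∈ fv′≈u′
                   (cut-position same (suc<⇒< q) (proj₁ u∈) (proj₁ u′∈) fresh-u cu (inside₁ u′ x₁ y₁))
                   (cut-position same q (P⊆Q q v∈) (P⊆Q q v′∈) fresh-v cv (inside₂ v′ x₂ y₂)))
             (f-extension q l₁ l₂)
      where
        module L = CutsAt same m (suc<⇒< q)
        module H = CutsAt same (suc m) q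
        counterparts : ∀ u′ v′ → Q∖P m (suc<⇒< q) u′ → P (suc m) q v′ → f m q v′ ≈ u′ →
                       Position R R′ u u′ → Position R R′ v v′ → Extension R R′ u × Extension R R′ v
        counterparts u′ v′ u′∈ v′∈ fv′≈u′ pos-u pos-v =
            extension u′ v v′ (swapAt m ⊕ g) (record
              { closed = Closed-⊎ (SwappedPair.closed q u∈ v∈ fv≈u) closed
              ; closed′ = Closed-⊎ (SwappedPair.closed q u′∈ v′∈ fv′≈u′) closed′
              ; same = SameDiagram-⊎ (SameDiagram-pair-sorted m≢1+m (proj₁ u∈) qv (proj₁ u′∈) qv′ kind-u kind-v) same
                         (SameCross-pair pos-u pos-v) })
          , extension v′ u u′ (swapAt m ⊕ g) (record
              { closed = Closed-⊎ (SwappedPair.closed′ q u∈ v∈ fv≈u) closed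
              ; closed′ = Closed-⊎ (SwappedPair.closed′ q u′∈ v′∈ fv′≈u′) closed′
              ; same = SameDiagram-⊎
                         (SameDiagram-pair-sorted (m≢1+m ∘ sym) qv (proj₁ u∈) qv′ (proj₁ u′∈) kind-v kind-u) same
                         (SameCross-pair pos-v pos-u) })
          where
            qv = P⊆Q q v∈
            qv′ = P⊆Q q v′∈
            m≢1+m : m ≢ suc m
            m≢1+m ()
            kind-u = SameKind-intro (proj₁ u∈) (proj₁ u′∈) (both-false (proj₂ u∈) (proj₂ u′∈))
            kind-v = SameKind-intro qv qv′ (both-true v∈ v′∈)

    extend-fresh : ∀ {a} → Fresh R a → Kind a → ¬ ¬ Extension R R′ a
    extend-fresh fresh (kind m p qa false ¬pa) with suc m <? n
    ... | yes q = ¬¬-map proj₁ (extend-pair q a∈ (f-Q∖P q a∈) (f-involutive q) fresh (Fresh-f closed m q fresh))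
      where a∈ = Q-irr qa , ¬pa ∘ P-irr
    ... | no ¬q = extend-fixed p qa fresh (λ z → ¬ P m p z) ¬pa (¬P-between p) both-false
                    (λ qz ¬pz k q → f-fixes qz k q (λ _ → ¬pz) (λ { refl → ⊥-elim (¬q q) }))
    extend-fresh fresh (kind zero p qa true pa) =
      extend-fixed p qa fresh (P zero p) pa (P-between p) both-true (λ qz pz k q → f-fixes qz k q (λ ()) (λ _ → pz))
    extend-fresh fresh (kind (suc m) q qa true pa) =
      ¬¬-map proj₂ (extend-pair q (f-P q pa) pa ≈-refl (Fresh-f closed m q fresh) fresh)

    extend : ∀ a → ¬ ¬ Extension R R′ a
    extend a = ¬¬-excluded-middle {A = ∃ λ j → a ≈ R j} >>= λ where
      (yes (j , a≈j)) → pure (extend-present j a≈j)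
      (no a∉R) → kindOf a >>= extend-fresh (λ j a≈j → a∉R (j , a≈j))

  termIndex : ∀ {k} → Action I → (Fin k → I) → Term n k → I
  termIndex g h (var i) = h i
  termIndex g h (fn m q t) = g m q (termIndex g h t)

  evalT-Closed : ∀ {k} {g : Action I} {R : I → U} → Closed g R → (h : Fin k → I) → (t : Term n k) →
                 R (termIndex g h t) ≈ evalT M (R ∘ h) t
  evalT-Closed closed h (var i) = ≈-refl
  evalT-Closed closed h (fn m q t) = ≈-trans (≈-sym (closed m q _)) (≈-cong (f m q) (evalT-Closed closed h t))

  adjoin : ∀ {k} → (Fin k → I) → Fin (suc k) → Bool ⊎ I
  adjoin h zero = inj₁ true
  adjoin h (suc i) = inj₂ (h i)

  adjoin-≗ : ∀ {k} {R : I → U} (h : Fin k → I) a b → (a ∷ᵥ R ∘ h) ≗ ([ pair a b , R ] ∘ adjoin h)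
  adjoin-≗ h a b zero = refl
  adjoin-≗ h a b (suc i) = refl

  transfer-atom : {g : Action I} {R R′ : I → U} → Matching g R R′ → ∀ {k} (h : Fin k → I) (F : U → U → Set) →
                  (∀ i j → (¬ ¬ F (R i) (R j)) ⇔ (¬ ¬ F (R′ i) (R′ j))) → ∀ t u →
                  ¬ ¬ F (evalT M (R ∘ h) t) (evalT M (R ∘ h) u) → ¬ ¬ F (evalT M (R′ ∘ h) t) (evalT M (R′ ∘ h) u)
  transfer-atom mat h F iff t u = to (⇔-resp-≈₂ F (ev t) (ev u) (ev′ t) (ev′ u) (iff _ _))
    where
      ev = evalT-Closed (Matching.closed mat) h
      ev′ = evalT-Closed (Matching.closed′ mat) h

  transfer : ∀ {k} (φ : Formula n k) {I} {g : Action I} {R R′ : I → U} → Listable I → Matching g R R′ →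
             (h : Fin k → I) → Sat M φ (R ∘ h) → Sat M φ (R′ ∘ h)
  transfer ⊥' en mat h s = s
  transfer (t ≐ u)      en mat h = transfer-atom mat h _≡_ (SD.≈-iff (Matching.same mat)) t u
  transfer (P' m p t)   en mat h = transfer-atom mat h (λ x _ → Pᴹ M m p x) (λ i _ → SD.P-iff (Matching.same mat) m p i) t t
  transfer (Q' m p t)   en mat h = transfer-atom mat h (λ x _ → Qᴹ M m p x) (λ i _ → SD.Q-iff (Matching.same mat) m p i) t t
  transfer (L' m p t u) en mat h = transfer-atom mat h (Lᴹ M m p) (SD.Lt-iff (Matching.same mat) m p) t u
  transfer (φ ∧' ψ) en mat h (sφ , sψ) = transfer φ en mat h sφ , transfer ψ en mat h sψ
  transfer (φ ∨' ψ) en mat h s (¬φ , ¬ψ) =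
    s ((¬φ ∘ transfer φ en mat h) , (¬ψ ∘ transfer ψ en mat h))
  transfer (φ ⇒' ψ) en mat h s = transfer ψ en mat h ∘ s ∘ transfer φ en (Matching-sym mat) h
  transfer (∀' φ) {R = R} {R′} en mat h s a′ = Sat-stable M φ _ (¬¬-map back-and-forth (extend en (Matching-sym mat) a′))
    where
      back-and-forth : Extension R′ R a′ → Sat M φ (a′ ∷ᵥ R′ ∘ h)
      back-and-forth (extension a b b′ _ mat′) =
        Sat-cong M φ (sym ∘ adjoin-≗ h a′ b)
          (transfer φ (Listable-⊎ Listable-Bool en) (Matching-sym mat′) (adjoin h)
            (Sat-cong M φ (adjoin-≗ h a b′) (s a)))
  transfer (∃' φ) en mat h s none′ = s λ a sa → extend en mat a λ where
    (extension a′ b b′ _ mat′) → none′ a′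
      (Sat-cong M φ (sym ∘ adjoin-≗ h a′ b′)
        (transfer φ (Listable-⊎ Listable-Bool en) mat′ (adjoin h) (Sat-cong M φ (adjoin-≗ h a b) sa)))

  -- Codes of tuples over parameters

  Kinds : ∀ {k} → Vector U k → Set
  Kinds {k} v = (j : Fin k) → Kind (v j)

  kindsOf : ∀ {k} (v : Vector U k) → ¬ ¬ Kinds v
  kindsOf {k} v = ¬¬-choice (Listable-Fin k) (kindOf ∘ v)

  closure : ∀ {k} {v : Vector U k} → Kinds v → Fin k × Bool → U
  closure {v = v} K (j , t) = pair (v j) (partner (K j)) t

  closureAction : ∀ {k} {v : Vector U k} → Kinds v → Action (Fin k × Bool)
  closureAction K k q (j , t) = j , kindAction (Kind.sort (K j)) (Kind.inP (K j)) k q t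

  closure-closed : ∀ {k} {v : Vector U k} (K : Kinds v) → Closed (closureAction K) (closure K)
  closure-closed K k q (j , t) = Kind-closed (K j) k q t

  all-sorts : {F : (m : ℕ) → m < n → Set} → (∀ k → F (toℕ k) (toℕ<n k)) → ∀ m p → F m p
  all-sorts {F} h m p = subst (uncurry F) (Σ-≡,≡→≡ (toℕ-fromℕ< p , <-irrelevant _ p)) (h (fromℕ< p))

  -- Questions about the closure of a q-tuple, whose elements are named by Fin q × Bool (an entry or its
  -- partner), and about how it sits relative to a parameter family A.
  data Question (q : ℕ) : Set where
    sort? inP?      : Fin q → Question q
    ≈?              : (e e′ : Fin q × Bool) → Question q
    lt?             : Fin n → (e e′ : Fin q × Bool) → Question q
    P? Q?           : Fin n → Fin q × Bool → Question q
    ≈A?             : Fin q × Bool → Question q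
    belowA? aboveA? : Fin n → Fin q × Bool → Question q

  Listable-Question : ∀ q → Listable (Question q)
  Listable-Question q = concat lists , complete
    where
      Fq = Listable-Fin q
      E = Listable-× Fq Listable-Bool
      EE = Listable-× E E
      FE = Listable-× (Listable-Fin n) E
      FEE = Listable-× (Listable-Fin n) EE
      lt?′ : Fin n × (Fin q × Bool) × (Fin q × Bool) → Question q
      lt?′ (k , e , e′) = lt? k e e′
      lists : List (List (Question q))
      lists = map sort? (proj₁ Fq) ∷ map inP? (proj₁ Fq) ∷ map (uncurry ≈?) (proj₁ EE) ∷ map lt?′ (proj₁ FEE)
            ∷ map (uncurry P?) (proj₁ FE) ∷ map (uncurry Q?) (proj₁ FE) ∷ map ≈A? (proj₁ E)
            ∷ map (uncurry belowA?) (proj₁ FE) ∷ map (uncurry aboveA?) (proj₁ FE) ∷ []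
      member : ∀ {X : Set} (c : X → Question q) (L : Listable X) x → map c (proj₁ L) ∈ lists → c x ∈ concat lists
      member c L x c[L]∈ = ∈-concat⁺′ {xss = lists} (∈-map⁺ c (proj₂ L x)) c[L]∈
      complete : ∀ x → x ∈ concat lists
      complete (sort? j)     = member sort? Fq j (here refl)
      complete (inP? j)      = member inP? Fq j (there (here refl))
      complete (≈? e e′)     = member (uncurry ≈?) EE (e , e′) (there (there (here refl)))
      complete (lt? k e e′)  = member lt?′ FEE (k , e , e′) (there (there (there (here refl))))
      complete (P? k e)      = member (uncurry P?) FE (k , e) (there (there (there (there (here refl)))))
      complete (Q? k e)      = member (uncurry Q?) FE (k , e) (there (there (there (there (there (here refl))))))
      complete (≈A? e)       = member ≈A? E e (there (there (there (there (there (there (here refl)))))))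
      complete (belowA? k e) = member (uncurry belowA?) FE (k , e) (there (there (there (there (there (there (there (here refl))))))))
      complete (aboveA? k e) =
        member (uncurry aboveA?) FE (k , e) (there (there (there (there (there (there (there (there (here refl)))))))))

  module Coding (N p : ℕ) (A : Fin N × (Fin p × Bool) → U) where

    Index : Set
    Index = Fin N × (Fin p × Bool)

    -- an answer is a sort (< n), a bit, or the indexCode of an optional index into A
    W : ℕ
    W = N * (p * 2) + suc (suc n)

    <n+2⇒<W : ∀ {x} → x < suc (suc n) → x < W
    <n+2⇒<W x<n+2 = <-≤-trans x<n+2 (m≤n+m (suc (suc n)) (N * (p * 2)))

    indexCode : Maybe Index → ℕ
    indexCode nothing = 0
    indexCode (just (i , j , t)) = suc (toℕ (combine i (combine j (fromBool t))))

    indexCode<W : ∀ v → indexCode v < W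
    indexCode<W nothing = <n+2⇒<W z<s
    indexCode<W (just (i , j , t)) = ≤-trans (s≤s (toℕ<n (combine i (combine j (fromBool t))))) (m<m+n (N * (p * 2)) z<s)

    indexCode-injective : ∀ v v′ → indexCode v ≡ indexCode v′ → v ≡ v′
    indexCode-injective nothing nothing _ = refl
    indexCode-injective (just (i , j , t)) (just (i′ , j′ , t′)) e
      with refl , e′ ← combine-injective i _ i′ _ (toℕ-injective (suc-injective e))
      with refl , e″ ← combine-injective j _ j′ _ e′
      with refl ← fromBool-injective e″ = refl

    Bit : Fin W → Set → Set
    Bit c X = (X × toℕ c ≡ 1) ⊎ (¬ X × toℕ c ≡ 0)

    Bit-⇔ : ∀ {c X Y} → Bit c X → Bit c Y → X ⇔ Y
    Bit-⇔ (inj₁ (x , _)) (inj₁ (y , _)) = both-true x y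
    Bit-⇔ (inj₂ (¬x , _)) (inj₂ (¬y , _)) = both-false ¬x ¬y
    Bit-⇔ (inj₁ (_ , c≡1)) (inj₂ (_ , c≡0)) with () ← trans (sym c≡1) c≡0
    Bit-⇔ (inj₂ (_ , c≡0)) (inj₁ (_ , c≡1)) with () ← trans (sym c≡1) c≡0

    decideBit : ∀ X → ¬ ¬ ∃ λ c → Bit c X
    decideBit X = ¬¬-map (λ where
      (yes x) → fromℕ< one<W , inj₁ (x , toℕ-fromℕ< one<W)
      (no ¬x) → fromℕ< zero<W , inj₂ (¬x , toℕ-fromℕ< zero<W)) ¬¬-excluded-middle
      where
        one<W = <n+2⇒<W (s≤s (s≤s z≤n))
        zero<W = <n+2⇒<W z<s

    Indexed : (Maybe Index → Set) → Fin W → Set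
    Indexed S c = ∃ λ v → toℕ c ≡ indexCode v × S v

    indexed : ∀ {S} v → S v → ∃ (Indexed S)
    indexed v s = fromℕ< (indexCode<W v) , v , toℕ-fromℕ< (indexCode<W v) , s

    Indexed-agree : ∀ {S S′ c} → Indexed S c → Indexed S′ c → ∃ λ v → S v × S′ v
    Indexed-agree (v , e , s) (v′ , e′ , s′) with refl ← indexCode-injective v v′ (trans (sym e) e′) = v , s , s′

    EqualIn : U → Maybe Index → Set
    EqualIn y (just w) = y ≈ A w
    EqualIn y nothing = ∀ w → ¬ y ≈ A w

    orderFin : (k : Fin n) → UnboundedOrder (Lt (toℕ k) (toℕ<n k)) (Q (toℕ k) (toℕ<n k))
    orderFin k = order (toℕ k) (toℕ<n k)

    Answer : ∀ {q} {v : Vector U q} → Kinds v → Question q → Fin W → Set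
    Answer K (sort? j)      c = toℕ c ≡ Kind.sort (K j)
    Answer K (inP? j)       c = Bit c (Kind.inP (K j) ≡ true)
    Answer K (≈? e e′)      c = Bit c (closure K e ≈ closure K e′)
    Answer K (lt? k e e′)   c = Bit c (Lt (toℕ k) (toℕ<n k) (closure K e) (closure K e′))
    Answer K (P? k e)       c = Bit c (P (toℕ k) (toℕ<n k) (closure K e))
    Answer K (Q? k e)       c = Bit c (Q (toℕ k) (toℕ<n k) (closure K e))
    Answer K (≈A? e)        c = Indexed (EqualIn (closure K e)) c
    Answer K (belowA? k e)  c = Indexed (Below.IsGreatestBelow (orderFin k) A (closure K e)) c
    Answer K (aboveA? k e)  c = Indexed (Below.IsGreatestBelow (reverse (orderFin k)) A (closure K e)) c

    answer : Listable Index → ∀ {q} {v : Vector U q} (K : Kinds v) x → ¬ ¬ ∃ (Answer K x)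
    answer en K (sort? j) = pure (fromℕ< sort<W , toℕ-fromℕ< sort<W)
      where sort<W = <n+2⇒<W (≤-trans (Kind.sort<n (K j)) (m≤n+m n 2))
    answer en K (inP? j)       = decideBit _
    answer en K (≈? e e′)      = decideBit _
    answer en K (lt? k e e′)   = decideBit _
    answer en K (P? k e)       = decideBit _
    answer en K (Q? k e)       = decideBit _
    answer en K (≈A? e)        = ¬¬-map (λ where
      (yes (w , e≈w)) → indexed (just w) e≈w
      (no ¬∃) → indexed nothing λ w e≈w → ¬∃ (w , e≈w)) (¬¬-excluded-middle {A = ∃ λ w → closure K e ≈ A w})
    answer en K (belowA? k e)  = ¬¬-map (uncurry indexed) (Below.greatestBelow (orderFin k) A en _)
    answer en K (aboveA? k e)  = ¬¬-map (uncurry indexed) (Below.greatestBelow (reverse (orderFin k)) A en _)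

    Code : ∀ {q} {v : Vector U q} → Kinds v → (Question q → Fin W) → Set
    Code K c = ∀ x → Answer K x (c x)

    code : Listable Index → ∀ {q} {v : Vector U q} (K : Kinds v) → ¬ ¬ ∃ (Code K)
    code en {q} K = ¬¬-map (λ h → proj₁ ∘ h , proj₂ ∘ h) (¬¬-choice (Listable-Question q) (answer en K))

    module SameCode {q} {v v′ : Vector U q} {K : Kinds v} {K′ : Kinds v′} {c : Question q → Fin W}
                    (code : Code K c) (code′ : Code K′ c) where

      sort-eq : ∀ j → Kind.sort (K j) ≡ Kind.sort (K′ j)
      sort-eq j = trans (sym (code (sort? j))) (code′ (sort? j))

      inP-eq : ∀ j → Kind.inP (K j) ≡ Kind.inP (K′ j)
      inP-eq j = ≡true-⇔⇒≡ (Bit-⇔ (code (inP? j)) (code′ (inP? j)))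

      same-diagram : SameDiagram (closure K) (closure K′)
      same-diagram = record
        { ≈-iff = λ e e′ → Bit-⇔ (code (≈? e e′)) (code′ (≈? e e′))
        ; P-iff = λ m p e → all-sorts (λ k → Bit-⇔ (code (P? k e)) (code′ (P? k e))) m p
        ; Q-iff = λ m p e → all-sorts (λ k → Bit-⇔ (code (Q? k e)) (code′ (Q? k e))) m p
        ; Lt-iff = λ m p e e′ → all-sorts (λ k → Bit-⇔ (code (lt? k e e′)) (code′ (lt? k e e′))) m p
        }

      same-cross : SameCross A (closure K) A (closure K′)
      same-cross = record
        { ≈-iff = λ w e → ≈-iff (Indexed-agree (code (≈A? e)) (code′ (≈A? e))) w
        ; <-iff = λ m p w e →
            all-sorts (λ k → below-iff k (Indexed-agree (code (belowA? k e)) (code′ (belowA? k e))) w) m p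
        ; >-iff = λ m p w e →
            all-sorts (λ k → below-iff′ k (Indexed-agree (code (aboveA? k e)) (code′ (aboveA? k e))) w) m p
        }
        where
          ≈-iff : ∀ {y y′} → (∃ λ v → EqualIn y v × EqualIn y′ v) → ∀ w → A w ≈ y ⇔ A w ≈ y′
          ≈-iff (just u , y≈u , y′≈u) w = mk⇔ (λ w≈y → ≈-trans w≈y (≈-trans y≈u (≈-sym y′≈u)))
                                               (λ w≈y′ → ≈-trans w≈y′ (≈-trans y′≈u (≈-sym y≈u)))
          ≈-iff (nothing , y∉ , y′∉) w = both-false (y∉ w ∘ ≈-sym) (y′∉ w ∘ ≈-sym)
          below-iff : ∀ k {y y′} →
                      (∃ λ v → Below.IsGreatestBelow (orderFin k) A y v × Below.IsGreatestBelow (orderFin k) A y′ v) →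
                      ∀ w → Lt (toℕ k) (toℕ<n k) (A w) y ⇔ Lt (toℕ k) (toℕ<n k) (A w) y′
          below-iff k (v , g , g′) w = mk⇔ (Below.IsGreatestBelow-⊏ (orderFin k) A v g g′ w)
                                           (Below.IsGreatestBelow-⊏ (orderFin k) A v g′ g w)
          below-iff′ : ∀ k {y y′} → (∃ λ v → Below.IsGreatestBelow (reverse (orderFin k)) A y v ×
                                            Below.IsGreatestBelow (reverse (orderFin k)) A y′ v) →
                       ∀ w → Lt (toℕ k) (toℕ<n k) y (A w) ⇔ Lt (toℕ k) (toℕ<n k) y′ (A w)
          below-iff′ k (v , g , g′) w = mk⇔ (Below.IsGreatestBelow-⊏ (reverse (orderFin k)) A v g g′ w)
                                            (Below.IsGreatestBelow-⊏ (reverse (orderFin k)) A v g′ g w)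

  module Independence {p q : ℕ} (φ : Formula n (p + q)) (a : ℕ → Vector U p) (b : (ℕ → Bool) → Vector U q)
    (ip : ∀ i s → (Sat M φ (a i ++ᵥ b s) → s i ≡ true) × (s i ≡ true → Sat M φ (a i ++ᵥ b s))) where

    r : ℕ
    r = length (proj₁ (Listable-Question q))

    N : ℕ
    N = proj₁ (polynomial<exponential (p * 2) (suc (suc n)) r)

    codes<subsets : (N * (p * 2) + suc (suc n)) ^ r < 2 ^ N
    codes<subsets = proj₂ (polynomial<exponential (p * 2) (suc (suc n)) r)

    module WithParameters (KA : (i : Fin N) → Kinds (a (toℕ i))) where

      A : Fin N × (Fin p × Bool) → U
      A (i , e) = closure (KA i) e

      actionA : Action (Fin N × (Fin p × Bool))
      actionA k q′ (i , e) = i , closureAction (KA i) k q′ e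

      A-closed : Closed actionA A
      A-closed k q′ (i , e) = closure-closed (KA i) k q′ e

      open Coding N p A

      Listable-Index : Listable Index
      Listable-Index = Listable-× (Listable-Fin N) (Listable-× (Listable-Fin p) Listable-Bool)

      Coded : (ℕ → Bool) → Set
      Coded s = Σ (Kinds (b s)) λ K → ∃ (Code K)

      coded : ∀ s → ¬ ¬ Coded s
      coded s = kindsOf (b s) >>= λ K → ¬¬-map (K ,_) (code Listable-Index K)

      matching : ∀ {s s′} {K : Kinds (b s)} {K′ : Kinds (b s′)} {c} → Code K c → Code K′ c →
                 Matching (actionA ⊕ closureAction K) [ A , closure K ] [ A , closure K′ ]
      matching {K = K} {K′} code code′ = record
        { closed = Closed-⊎ A-closed (closure-closed K)
        ; closed′ = Closed-⊎ A-closed (Closed-resp same-action (closure-closed K′))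
        ; same = SameDiagram-⊎ (SameDiagram-refl A) same-diagram same-cross
        }
        where
          open SameCode code code′
          same-action : ∀ k q′ j → closureAction K k q′ j ≡ closureAction K′ k q′ j
          same-action k q′ (j , t) = cong (j ,_) (cong₂ (λ m b → kindAction m b k q′ t) (sort-eq j) (inP-eq j))

      listable : Listable (Index ⊎ (Fin q × Bool))
      listable = Listable-⊎ Listable-Index (Listable-× (Listable-Fin q) Listable-Bool)

      variables : Fin N → Fin (p + q) → Index ⊎ (Fin q × Bool)
      variables i z = [ (λ j → inj₁ (i , j , true)) , (λ j → inj₂ (j , true)) ] (splitAt p z)

      variables-≗ : ∀ i {s} (K : Kinds (b s)) → (a (toℕ i) ++ᵥ b s) ≗ [ A , closure K ] ∘ variables i
      variables-≗ i K z with splitAt p z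
      ... | inj₁ j = refl
      ... | inj₂ j = refl

      φ-transfer : ∀ i {s s′} {K : Kinds (b s)} {K′ : Kinds (b s′)} {c} → Code K c → Code K′ c →
                   Sat M φ (a (toℕ i) ++ᵥ b s) → Sat M φ (a (toℕ i) ++ᵥ b s′)
      φ-transfer i {K = K} {K′} code code′ =
        Sat-cong M φ (sym ∘ variables-≗ i K′)
        ∘ transfer φ listable (matching code code′) (variables i)
        ∘ Sat-cong M φ (variables-≗ i K)

      same-code⇒same-membership : ∀ {s s′} (C : Coded s) (C′ : Coded s′) → proj₁ (proj₂ C) ≗ proj₁ (proj₂ C′) →
                           ∀ i → s (toℕ i) ≡ s′ (toℕ i)
      same-code⇒same-membership {s} {s′} (K , c , code) (K′ , c′ , code′) c≗c′ i = ≡true-⇔⇒≡ (mk⇔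
        (proj₁ (ip _ s′) ∘ φ-transfer i code code″ ∘ proj₂ (ip _ s))
        (proj₁ (ip _ s) ∘ φ-transfer i code″ code ∘ proj₂ (ip _ s′)))
        where
          code″ : Code K′ c
          code″ x = subst (Answer K′ x) (sym (c≗c′ x)) (code′ x)

      contradiction : ¬ ¬ ⊥
      contradiction = ¬¬-map impossible (¬¬-choice (Listable-Fin (2 ^ N)) (coded ∘ bit N))
        where
          impossible : (∀ z → Coded (bit N z)) → ⊥
          impossible C = collision (functions-collide (Listable-Question q) codes<subsets (λ z → proj₁ (proj₂ (C z))))
            where
              collision : (∃₂ λ z₁ z₂ → z₁ Fin.< z₂ × proj₁ (proj₂ (C z₁)) ≗ proj₁ (proj₂ (C z₂))) → ⊥
              collision (z₁ , z₂ , z₁<z₂ , c≗c′) = <-irrefl (bit-injective N z₁ z₂ same-bits) z₁<z₂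
                where
                  same-bits : ∀ i → i < N → bit N z₁ i ≡ bit N z₂ i
                  same-bits i i<N = subst (λ i → bit N z₁ i ≡ bit N z₂ i) (toℕ-fromℕ< i<N)
                                      (same-code⇒same-membership (C z₁) (C z₂) c≗c′ (fromℕ< i<N))

    contradiction : ¬ ¬ ⊥
    contradiction = ¬¬-choice (Listable-Fin N) (λ i → kindsOf (a (toℕ i))) >>= WithParameters.contradiction

proposition3p6 : (n : ℕ) → Dependent n
proposition3p6 n (M , isM , p , q , φ , a , b , ip) = Stable-⊥ (Model.Independence.contradiction M isM φ a b ip)
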